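{- Let $k\ge 2$ be an integer and $G$ a connected graph with at least $k$ vertices. (1) If $D$ is a connected $k$-dominating set of $G$, then $rx_k(G)\leq rx_k(G[D])+k$; consequently $rx_k(G)\leq \gamma_k^c(G)+k-1$. (2) If $G$ has minimum degree at least $k$ and $D$ is a connected $(k-1)$-dominating set of $G$, then $rx_k(G)\leq rx_k(G[D])+k+1$; consequently $rx_k(G)\leq \gamma_{k-1}^c(G)+k$.
   Context: All graphs are simple, finite and undirected. For $D\subseteq V(G)$, $G[D]$ is the subgraph induced by $D$ and $\overline{D}=V(G)\setminus D$. For a positive integer $j$, a set $D\subseteq V(G)$ is a $j$-dominating set if every vertex of $\overline{D}$ is adjacent to at least $j$ distinct vertices of $D$; it is a connected $j$-dominating set if moreover $G[D]$ is connected. The connected $j$-domination number $\gamma_j^c(G)$ is the minimum cardinality of a connected $j$-dominating set of $G$. For an edge-coloring of a connected graph $H$ (adjacent edges may receive the same color), a tree in $H$ is a rainbow tree if no two of its edges receive the same color. For an integer $k$ with $2\leq k\leq |V(H)|$, an edge-coloring is a $k$-rainbow coloring if for every set $S$ of $k$ vertices of $H$ there is a rainbow tree in $H$ containing all vertices of $S$; the $k$-rainbow index $rx_k(H)$ is the minimum number of colors in a $k$-rainbow coloring of $H$. -}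

module Defs where

open import Data.Nat using (ℕ; suc; _≤_; _+_)
open import Data.Fin using (Fin)
open import Data.Bool using (Bool; true; false)
open import Data.Product using (Σ; _×_; _,_; ∃; ∃-syntax)
open import Data.List using (List; map; length)
open import Data.List.Membership.Propositional using () renaming (_∈_ to _∈ˡ_)
open import Data.List.Relation.Unary.Unique.Propositional using (Unique)
open import Data.Fin.Subset using (Subset; _∈_; _∉_; _⊆_; ∣_∣; _∩_; ⊤)
open import Data.Vec using (tabulate)
open import Relation.Binary.PropositionalEquality using (_≡_)
open import Relation.Nullary using (¬_)

record Graph (n : ℕ) : Set where
  field
    adj   : Fin n → Fin n → Bool
    sym   : ∀ u v → adj u v ≡ adj v u
    irref : ∀ v → adj v v ≡ false
open Graph public

Adj : ∀ {n} → Graph n → Fin n → Fin n → Set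
Adj G u v = adj G u v ≡ true

nbrs : ∀ {n} → Graph n → Fin n → Subset n
nbrs G v = tabulate (adj G v)

-- walks in G all of whose vertices lie in W (i.e. walks in the induced subgraph G[W])
data WalkIn {n} (G : Graph n) (W : Subset n) : Fin n → Fin n → Set where
  here : ∀ {v} → v ∈ W → WalkIn G W v v
  step : ∀ {u w v} → u ∈ W → Adj G u w → WalkIn G W w v → WalkIn G W u v

ConnectedOn : ∀ {n} → Graph n → Subset n → Set
ConnectedOn G W = (∃[ v ] v ∈ W) × (∀ u v → u ∈ W → v ∈ W → WalkIn G W u v)

Connected : ∀ {n} → Graph n → Set
Connected G = ConnectedOn G ⊤

MinDegree≥ : ∀ {n} → Graph n → ℕ → Set
MinDegree≥ G d = ∀ v → d ≤ ∣ nbrs G v ∣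

IsDominating : ∀ {n} → Graph n → ℕ → Subset n → Set
IsDominating G j D = ∀ v → v ∉ D → j ≤ ∣ nbrs G v ∩ D ∣

IsConnDominating : ∀ {n} → Graph n → ℕ → Subset n → Set
IsConnDominating G j D = IsDominating G j D × ConnectedOn G D

IsConnDomNumber : ∀ {n} → Graph n → ℕ → ℕ → Set
IsConnDomNumber G j g =
  (∃[ D ] (IsConnDominating G j D × ∣ D ∣ ≡ g)) ×
  (∀ D → IsConnDominating G j D → g ≤ ∣ D ∣)

-- an edge colouring with (at most) r colours; colours of non-edges are irrelevant
record Colouring {n} (G : Graph n) (r : ℕ) : Set where
  field
    col    : Fin n → Fin n → Fin r
    colSym : ∀ u v → col u v ≡ col v u
open Colouring public

Edge : ℕ → Set
Edge n = Fin n × Fin n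

data ReachE {n} (E : List (Edge n)) : Fin n → Fin n → Set where
  here  : ∀ {v} → ReachE E v v
  stepˡ : ∀ {u w v} → (u , w) ∈ˡ E → ReachE E w v → ReachE E u v
  stepʳ : ∀ {u w v} → (w , u) ∈ˡ E → ReachE E w v → ReachE E u v

-- (T , E) is a tree of the induced subgraph G[W]: T ⊆ W, every edge of E is an edge
-- of G with both ends in T, (T , E) is connected and |E| + 1 = |T|.
-- (A finite graph is a tree iff it is connected and has one edge fewer than vertices.)
IsTreeIn : ∀ {n} → Graph n → Subset n → Subset n → List (Edge n) → Set
IsTreeIn G W T E =
  T ⊆ W ×
  (∀ {u v} → (u , v) ∈ˡ E → Adj G u v × u ∈ T × v ∈ T) ×
  (∀ u v → u ∈ T → v ∈ T → ReachE E u v) ×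
  suc (length E) ≡ ∣ T ∣

IsRainbow : ∀ {n} {G : Graph n} {r} → Colouring G r → List (Edge n) → Set
IsRainbow c E = Unique (map (λ e → col c (Data.Product.proj₁ e) (Data.Product.proj₂ e)) E)

IsKRainbowOn : ∀ {n} (G : Graph n) (W : Subset n) (k : ℕ) {r} → Colouring G r → Set
IsKRainbowOn G W k c =
  ∀ S → S ⊆ W → ∣ S ∣ ≡ k →
    ∃[ T ] ∃[ E ] (IsTreeIn G W T E × S ⊆ T × IsRainbow c E)

IsRainbowIndexOn : ∀ {n} → Graph n → Subset n → ℕ → ℕ → Set
IsRainbowIndexOn G W k r =
  ConnectedOn G W × 2 ≤ k × k ≤ ∣ W ∣ ×
  (Σ (Colouring G r) (IsKRainbowOn G W k)) ×
  (∀ r' → (c : Colouring G r') → IsKRainbowOn G W k c → r ≤ r')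

IsRainbowIndex : ∀ {n} → Graph n → ℕ → ℕ → Set
IsRainbowIndex G k r = IsRainbowIndexOn G ⊤ k r

module Submission where

-- Let D be a connected dominating set. Colour the edges of G in two ranges: edges of
-- G[D] get "high" colours ≥ p from a colouring C of G[D] in which every set of at most k
-- vertices of D lies in a tree of G[D] with distinct colours (a high rainbow cover); edges
-- leaving D get "low" colours < p. Given S with |S| = k, hang every vertex of S ∖ D as a leaf
-- on a D-neighbour, choosing pendant edges of distinct low colours; the parents together with
-- S ∩ D are at most k vertices of D, hence lie in a high rainbow tree of G[D], and attaching
-- the leaves gives a rainbow tree of G containing S (rainbow-tree-from-leaves).
--   (1) D k-dominating, p = k: the i-th vertex of S ∖ D uses its i-th D-neighbour.
--   (2) D (k-1)-dominating and δ(G) ≥ k, p = k + 1: a Boolean labelling of V ∖ D, found by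
--       local search, tells each vertex whether to number its D-neighbours upwards or
--       downwards; colour k on edges outside D handles the case S ∩ D = ∅ with all labels equal.
-- The cover C comes from an optimal k-rainbow colouring of G[D] (shifted by p) or from a
-- spanning tree of G[D] with distinct edge colours (|D| - 1 colours); this yields the bounds
-- by rx_k(G[D]) and by γ^c.

open import Defs
open import Data.Nat using (ℕ; zero; suc; _≤_; _<_; _+_; _∸_; z≤n; s≤s; _≤?_)
open import Data.Nat.Properties
open import Data.Bool using (Bool; true; false; not)
import Data.Bool as Bool
open import Data.Fin using (Fin; zero; suc; toℕ; _↑ʳ_; _↑ˡ_; inject₁; fromℕ; opposite)
import Data.Fin as Fin
import Data.Fin.Properties as FP
open import Data.Fin.Subset using (Subset; inside; outside; _∈_; _∉_; _⊆_; ∣_∣; ⊤; ⊥; _∩_; _-_)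
open import Data.Fin.Subset.Properties
  using (_∈?_; ∈⊤; ∉⊥; ∣⊥∣≡0; p⊆q⇒∣p∣≤∣q∣; x∈p∩q⁺; x∈p∩q⁻; x∈p⇒∣p-x∣<∣p∣; x∈p∧x≢y⇒x∈p-y; ⊆-antisym)
open import Data.Vec using ([]; _∷_; tabulate; here; there)
open import Data.Vec.Properties using ([]=⇒lookup; lookup⇒[]=; lookup∘tabulate)
open import Data.List using (List; []; _∷_; length; map; _++_; filter)
open import Data.List.Properties using (length-map; length-++; map-++; map-∘; map-id; ++-assoc; ++-identityʳ)
open import Data.List.Membership.Propositional using () renaming (_∈_ to _∈ˡ_)
open import Data.List.Membership.Propositional.Properties
  using (∈-map⁺; ∈-map⁻; ∈-++⁺ˡ; ∈-++⁺ʳ; ∈-++⁻; ∈-filter⁺; ∈-filter⁻)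
open import Data.List.Relation.Unary.Any as Any using (here; there)
open import Data.List.Relation.Unary.All using (All; []; _∷_)
import Data.List.Relation.Unary.All as All
import Data.List.Relation.Unary.All.Properties as AllP
open import Data.List.Relation.Unary.AllPairs as AP using (AllPairs)
import Data.List.Relation.Unary.AllPairs.Properties as AllPairsP
open import Data.List.Relation.Unary.Unique.Propositional using (Unique; []; _∷_)
import Data.List.Relation.Unary.Unique.Propositional.Properties as UniqueP
open import Data.Product using (Σ; _×_; _,_; ∃-syntax; proj₁; proj₂)
open import Data.Sum using (_⊎_; inj₁; inj₂; [_,_]′; map₂)
open import Data.Unit using (tt) renaming (⊤ to Unit)
open import Data.Empty using (⊥-elim)
open import Data.Maybe using (Maybe; just; nothing; maybe)
import Data.Maybe as Maybe
open import Data.Maybe.Properties using () renaming (map-injective to maybe-map-injective)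
open import Relation.Nullary using (¬_; yes; no; Dec; ¬?; does)
open import Relation.Nullary.Decidable using (_×-dec_; _⊎-dec_; decidable-stable; dec-true)
open import Level using (0ℓ)
open import Relation.Unary using (Pred; Decidable)
open import Relation.Binary.PropositionalEquality
  using (_≡_; _≢_; refl; trans; cong; cong₂; subst; subst₂) renaming (sym to ≡-sym)

private variable n : ℕ

insert : Fin n → Subset n → Subset n
insert zero    (_ ∷ p) = inside ∷ p
insert (suc x) (b ∷ p) = b ∷ insert x p

insert-here : ∀ (x : Fin n) p → x ∈ insert x p
insert-here zero    (_ ∷ p) = here
insert-here (suc x) (_ ∷ p) = there (insert-here x p)

insert-there : ∀ (x : Fin n) {y} p → y ∈ p → y ∈ insert x p
insert-there zero    {zero}  (_ ∷ p) here      = here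
insert-there zero    {suc y} (_ ∷ p) (there h) = there h
insert-there (suc x) {zero}  (_ ∷ p) here      = here
insert-there (suc x) {suc y} (_ ∷ p) (there h) = there (insert-there x p h)

insert-inv : ∀ (x : Fin n) {y} p → y ∈ insert x p → y ≡ x ⊎ y ∈ p
insert-inv zero    {zero}  (_ ∷ p) h         = inj₁ refl
insert-inv zero    {suc y} (_ ∷ p) (there h) = inj₂ (there h)
insert-inv (suc x) {zero}  (_ ∷ p) here      = inj₂ here
insert-inv (suc x) {suc y} (_ ∷ p) (there h) with insert-inv x p h
... | inj₁ y≡x = inj₁ (cong suc y≡x)
... | inj₂ y∈p = inj₂ (there y∈p)

insert-⊆ : ∀ {x : Fin n} {p W} → x ∈ W → p ⊆ W → insert x p ⊆ W
insert-⊆ {x = x} {p} x∈W p⊆W h = [ (λ { refl → x∈W }) , p⊆W ]′ (insert-inv x p h)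

∣insert∣ : ∀ (x : Fin n) p → x ∉ p → ∣ insert x p ∣ ≡ suc ∣ p ∣
∣insert∣ zero    (inside  ∷ p) x∉p = ⊥-elim (x∉p here)
∣insert∣ zero    (outside ∷ p) x∉p = refl
∣insert∣ (suc x) (inside  ∷ p) x∉p = cong suc (∣insert∣ x p (λ h → x∉p (there h)))
∣insert∣ (suc x) (outside ∷ p) x∉p = ∣insert∣ x p (λ h → x∉p (there h))

∣insert∣≤ : ∀ (x : Fin n) p → ∣ insert x p ∣ ≤ suc ∣ p ∣
∣insert∣≤ zero    (inside  ∷ p) = n≤1+n _
∣insert∣≤ zero    (outside ∷ p) = ≤-refl
∣insert∣≤ (suc x) (inside  ∷ p) = s≤s (∣insert∣≤ x p)
∣insert∣≤ (suc x) (outside ∷ p) = ∣insert∣≤ x p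

∣singleton∣ : ∀ (x : Fin n) → ∣ insert x ⊥ ∣ ≡ 1
∣singleton∣ {n} x = trans (∣insert∣ x ⊥ ∉⊥) (cong suc (∣⊥∣≡0 n))

singleton-inv : ∀ {x y : Fin n} → y ∈ insert x ⊥ → y ≡ x
singleton-inv {x = x} h = [ (λ e → e) , (λ h' → ⊥-elim (∉⊥ h')) ]′ (insert-inv x ⊥ h)

toList : Subset n → List (Fin n)
toList []            = []
toList (inside  ∷ p) = zero ∷ map suc (toList p)
toList (outside ∷ p) = map suc (toList p)

length-toList : (p : Subset n) → length (toList p) ≡ ∣ p ∣
length-toList []            = refl
length-toList (inside  ∷ p) = cong suc (trans (length-map suc (toList p)) (length-toList p))
length-toList (outside ∷ p) = trans (length-map suc (toList p)) (length-toList p)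

toList⁺ : ∀ {p : Subset n} {x} → x ∈ p → x ∈ˡ toList p
toList⁺ {p = inside  ∷ p} here      = here refl
toList⁺ {p = inside  ∷ p} (there h) = there (∈-map⁺ suc (toList⁺ h))
toList⁺ {p = outside ∷ p} (there h) = ∈-map⁺ suc (toList⁺ h)

toList⁻ : ∀ {p : Subset n} {x} → x ∈ˡ toList p → x ∈ p
toList⁻ {p = inside ∷ p} (here refl) = here
toList⁻ {p = inside ∷ p} (there h) with ∈-map⁻ suc h
... | y , hy , refl = there (toList⁻ hy)
toList⁻ {p = outside ∷ p} h with ∈-map⁻ suc h
... | y , hy , refl = there (toList⁻ hy)

toList-unique : (p : Subset n) → Unique (toList p)
toList-unique []            = []
toList-unique (inside  ∷ p) =
  AllP.map⁺ (All.universal (λ _ ()) (toList p)) ∷ UniqueP.map⁺ FP.suc-injective (toList-unique p)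
toList-unique (outside ∷ p) = UniqueP.map⁺ FP.suc-injective (toList-unique p)

fromList : List (Fin n) → Subset n
fromList []       = ⊥
fromList (x ∷ xs) = insert x (fromList xs)

fromList⁺ : ∀ {xs : List (Fin n)} {x} → x ∈ˡ xs → x ∈ fromList xs
fromList⁺ {xs = y ∷ xs} (here refl) = insert-here y (fromList xs)
fromList⁺ {xs = y ∷ xs} (there h)   = insert-there y (fromList xs) (fromList⁺ h)

fromList⁻ : ∀ {xs : List (Fin n)} {x} → x ∈ fromList xs → x ∈ˡ xs
fromList⁻ {xs = []}     h = ⊥-elim (∉⊥ h)
fromList⁻ {xs = y ∷ xs} h with insert-inv y (fromList xs) h
... | inj₁ refl = here refl
... | inj₂ h'   = there (fromList⁻ h')

∣fromList∣≤ : (xs : List (Fin n)) → ∣ fromList xs ∣ ≤ length xs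
∣fromList∣≤ {n} []       = ≤-reflexive (∣⊥∣≡0 n)
∣fromList∣≤ (x ∷ xs) = ≤-trans (∣insert∣≤ x (fromList xs)) (s≤s (∣fromList∣≤ xs))

∃-new-element : ∀ (p q : Subset n) → ∣ p ∣ < ∣ q ∣ → ∃[ x ] (x ∈ q × x ∉ p)
∃-new-element p q ∣p∣<∣q∣ with FP.any? (λ x → (x ∈? q) ×-dec (¬? (x ∈? p)))
... | yes found = found
... | no none = ⊥-elim (<⇒≱ ∣p∣<∣q∣ (p⊆q⇒∣p∣≤∣q∣ q⊆p))
  where
  q⊆p : q ⊆ p
  q⊆p {x} x∈q with x ∈? p
  ... | yes x∈p = x∈p
  ... | no  x∉p = ⊥-elim (none (x , x∈q , x∉p))

extend-to-size : ∀ (D S : Subset n) k → S ⊆ D → ∣ S ∣ ≤ k → k ≤ ∣ D ∣ →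
  ∃[ S' ] (S ⊆ S' × S' ⊆ D × ∣ S' ∣ ≡ k)
extend-to-size D S k S⊆D ∣S∣≤k k≤∣D∣ = go (k ∸ ∣ S ∣) S (m∸n+n≡m ∣S∣≤k) S⊆D
  where
  go : ∀ f S → f + ∣ S ∣ ≡ k → S ⊆ D → ∃[ S' ] (S ⊆ S' × S' ⊆ D × ∣ S' ∣ ≡ k)
  go zero    S size S⊆D = S , (λ h → h) , S⊆D , size
  go (suc f) S size S⊆D with ∃-new-element S D (≤-trans (subst (∣ S ∣ <_) size (s≤s (m≤n+m _ f))) k≤∣D∣)
  ... | x , x∈D , x∉S with go f (insert x S) (trans (cong (f +_) (∣insert∣ x S x∉S)) (trans (+-suc f _) size))
                             (insert-⊆ x∈D S⊆D)
  ... | S' , S⊆S' , S'⊆D , ∣S'∣ = S' , (λ h → S⊆S' (insert-there x S h)) , S'⊆D , ∣S'∣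

reach-mono : ∀ {E E' : List (Edge n)} → (∀ {e} → e ∈ˡ E → e ∈ˡ E') →
  ∀ {u v} → ReachE E u v → ReachE E' u v
reach-mono E⊆E' here          = here
reach-mono E⊆E' (stepˡ e r)   = stepˡ (E⊆E' e) (reach-mono E⊆E' r)
reach-mono E⊆E' (stepʳ e r)   = stepʳ (E⊆E' e) (reach-mono E⊆E' r)

reach-trans : ∀ {E : List (Edge n)} {u v w} → ReachE E u v → ReachE E v w → ReachE E u w
reach-trans here        r' = r'
reach-trans (stepˡ e r) r' = stepˡ e (reach-trans r r')
reach-trans (stepʳ e r) r' = stepʳ e (reach-trans r r')

add-leaf : ∀ (G : Graph n) W T E {v t} → IsTreeIn G W T E → v ∈ W → v ∉ T → t ∈ T → Adj G v t →
  IsTreeIn G W (insert v T) (E ++ (v , t) ∷ [])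
add-leaf {n} G W T E {v} {t} (T⊆W , edges , reach , size) v∈W v∉T t∈T v~t =
  insert-⊆ v∈W T⊆W , edges' , reach' , size'
  where
  E' : List (Edge n)
  E' = E ++ (v , t) ∷ []
  old : ∀ {e} → e ∈ˡ E → e ∈ˡ E'
  old = ∈-++⁺ˡ
  new : (v , t) ∈ˡ E'
  new = ∈-++⁺ʳ E (here refl)
  edges' : ∀ {x y} → (x , y) ∈ˡ E' → Adj G x y × x ∈ insert v T × y ∈ insert v T
  edges' h with ∈-++⁻ E h
  ... | inj₁ h' = let (x~y , x∈T , y∈T) = edges h' in x~y , insert-there v T x∈T , insert-there v T y∈T
  ... | inj₂ (here refl) = v~t , insert-here v T , insert-there v T t∈T
  reach' : ∀ x y → x ∈ insert v T → y ∈ insert v T → ReachE E' x y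
  reach' x y hx hy with insert-inv v T hx | insert-inv v T hy
  ... | inj₁ refl | inj₁ refl = here
  ... | inj₁ refl | inj₂ y∈T  = stepˡ new (reach-mono old (reach _ _ t∈T y∈T))
  ... | inj₂ x∈T  | inj₁ refl = reach-trans (reach-mono old (reach _ _ x∈T t∈T)) (stepʳ new here)
  ... | inj₂ x∈T  | inj₂ y∈T  = reach-mono old (reach _ _ x∈T y∈T)
  size' : suc (length E') ≡ ∣ insert v T ∣
  size' = trans (cong suc (trans (length-++ E) (+-comm (length E) 1)))
                (trans (cong suc size) (≡-sym (∣insert∣ v T v∉T)))

-- A list of leaf edges (v , t) is attachable to the vertices A when each parent t lies
-- in A or is the leaf of an earlier edge of the list.
ParentsIn : List (Fin n) → List (Edge n) → Set
ParentsIn A []             = Unit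
ParentsIn A ((v , t) ∷ L) = t ∈ˡ A × ParentsIn (v ∷ A) L

parentsIn-start : ∀ (A : List (Fin n)) L → All (λ e → proj₂ e ∈ˡ A) L → ParentsIn A L
parentsIn-start A []            _        = tt
parentsIn-start A ((v , t) ∷ L) (t∈A ∷ rest) = t∈A , parentsIn-start (v ∷ A) L (All.map there rest)

parentsIn-mono : ∀ (A A' : List (Fin n)) L → (∀ {x} → x ∈ˡ A → x ∈ˡ A') → ParentsIn A L → ParentsIn A' L
parentsIn-mono A A' []            A⊆A' _            = tt
parentsIn-mono A A' ((v , t) ∷ L) A⊆A' (t∈A , rest) =
  A⊆A' t∈A , parentsIn-mono (v ∷ A) (v ∷ A') L (λ { (here e) → here e ; (there z) → there (A⊆A' z) }) rest

parentsIn-++ : ∀ (A : List (Fin n)) L₁ L₂ → ParentsIn A L₁ → ParentsIn (map proj₁ L₁ ++ A) L₂ →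
  ParentsIn A (L₁ ++ L₂)
parentsIn-++ A []             L₂ _          p₂ = p₂
parentsIn-++ A ((v , t) ∷ L₁) L₂ (t∈A , p₁) p₂ = t∈A , parentsIn-++ (v ∷ A) L₁ L₂ p₁ (parentsIn-mono _ _ L₂ swap p₂)
  where
  swap : ∀ {x} → x ∈ˡ (v ∷ map proj₁ L₁ ++ A) → x ∈ˡ (map proj₁ L₁ ++ v ∷ A)
  swap (here e)  = ∈-++⁺ʳ (map proj₁ L₁) (here e)
  swap (there z) with ∈-++⁻ (map proj₁ L₁) z
  ... | inj₁ z' = ∈-++⁺ˡ z'
  ... | inj₂ z' = ∈-++⁺ʳ (map proj₁ L₁) (there z')

add-leaves : ∀ {Colour : Set} (G : Graph n) W (colour : Edge n → Colour) L A T E → IsTreeIn G W T E →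
  (∀ {x} → x ∈ˡ A → x ∈ T) → All (λ e → proj₁ e ∉ T) L → Unique (map proj₁ L) →
  ParentsIn A L → All (λ e → Adj G (proj₁ e) (proj₂ e)) L → All (λ e → proj₁ e ∈ W) L →
  Unique (map colour (E ++ L)) →
  ∃[ T' ] ∃[ E' ] (IsTreeIn G W T' E' × T ⊆ T' × All (λ e → proj₁ e ∈ T') L × Unique (map colour E'))
add-leaves G W colour [] A T E tree _ _ _ _ _ _ u =
  T , E , tree , (λ h → h) , [] , subst (λ z → Unique (map colour z)) (++-identityʳ E) u
add-leaves G W colour ((v , t) ∷ L) A T E tree A⊆T (v∉T ∷ L∉T) (v∉L ∷ uL) (t∈A , pL) (v~t ∷ adjL) (v∈W ∷ L⊆W) u
  with add-leaves G W colour L (v ∷ A) (insert v T) (E ++ (v , t) ∷ []) (add-leaf G W T E tree v∈W v∉T (A⊆T t∈A) v~t)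
         A⊆T' (fresh L∉T v∉L) uL pL adjL L⊆W (subst (λ z → Unique (map colour z)) (≡-sym (++-assoc E ((v , t) ∷ []) L)) u)
  where
  A⊆T' : ∀ {x} → x ∈ˡ (v ∷ A) → x ∈ insert v T
  A⊆T' (here refl) = insert-here v T
  A⊆T' (there h)   = insert-there v T (A⊆T h)
  fresh : ∀ {L'} → All (λ e → proj₁ e ∉ T) L' → All (λ y → v ≢ y) (map proj₁ L') →
    All (λ e → proj₁ e ∉ insert v T) L'
  fresh []         []         = []
  fresh (p ∷ ps) (q ∷ qs) = (λ h → [ (λ e → q (≡-sym e)) , p ]′ (insert-inv v T h)) ∷ fresh ps qs
... | T' , E' , tree' , T⊆T' , L⊆T' , u' =
  T' , E' , tree' , (λ h → T⊆T' (insert-there v T h)) , T⊆T' (insert-here v T) ∷ L⊆T' , u'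

-- Edges are unordered: (a , b) matches both (a , b) and (b , a).
Match : Edge n → Edge n → Set
Match (a , b) (u , w) = (a ≡ u × b ≡ w) ⊎ (a ≡ w × b ≡ u)

match? : (e f : Edge n) → Dec (Match e f)
match? (a , b) (u , w) = ((a FP.≟ u) ×-dec (b FP.≟ w)) ⊎-dec ((a FP.≟ w) ×-dec (b FP.≟ u))

match-flip : ∀ (e : Edge n) {u w} → Match e (u , w) → Match e (w , u)
match-flip _ (inj₁ (x , y)) = inj₂ (x , y)
match-flip _ (inj₂ (x , y)) = inj₁ (x , y)

match-refl : ∀ (e : Edge n) → Match e e
match-refl _ = inj₁ (refl , refl)

NoRepeatedEdge : List (Edge n) → Set
NoRepeatedEdge = AllPairs (λ e f → ¬ Match e f)

-- Every connected G[D] has a spanning tree (with no repeated edge): starting from a single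
-- vertex v₀, repeatedly attach a vertex of D outside the tree that is adjacent to it, found
-- on a walk in G[D] from an outside vertex to v₀.
module SpanningTree (G : Graph n) (D : Subset n) (v₀ : Fin n) (v₀∈D : v₀ ∈ D)
  (walk : ∀ u v → u ∈ D → v ∈ D → WalkIn G D u v) where

  crossing : ∀ {T x y} → WalkIn G D x y → x ∉ T → y ∈ T →
    ∃[ u ] ∃[ w ] (u ∈ D × u ∉ T × w ∈ T × Adj G u w)
  crossing (here _) x∉T x∈T = ⊥-elim (x∉T x∈T)
  crossing {T} (step {w = w} x∈D x~w wk) x∉T y∈T with w ∈? T
  ... | yes w∈T = _ , w , x∈D , x∉T , w∈T , x~w
  ... | no  w∉T = crossing wk w∉T y∈T

  grow : ∀ f T E → f + ∣ T ∣ ≡ ∣ D ∣ → IsTreeIn G D T E → v₀ ∈ T → NoRepeatedEdge E →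
    ∃[ T' ] ∃[ E' ] (IsTreeIn G D T' E' × D ⊆ T' × NoRepeatedEdge E')
  grow f T E size tree v₀∈T norep with FP.any? (λ x → (x ∈? D) ×-dec ¬? (x ∈? T))
  ... | no none = T , E , tree , D⊆T , norep
    where
    D⊆T : D ⊆ T
    D⊆T {x} x∈D with x ∈? T
    ... | yes x∈T = x∈T
    ... | no  x∉T = ⊥-elim (none (x , x∈D , x∉T))
  ... | yes (x , x∈D , x∉T) with crossing {T} (walk x v₀ x∈D v₀∈D) x∉T v₀∈T
  ...   | u , w , u∈D , u∉T , w∈T , u~w = continue f size
    where
    tree' : IsTreeIn G D (insert u T) (E ++ (u , w) ∷ [])
    tree' = add-leaf G D T E tree u∈D u∉T w∈T u~w
    -- the new edge touches u ∉ T, so it repeats no edge of the tree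
    norep' : NoRepeatedEdge (E ++ (u , w) ∷ [])
    norep' = AllPairsP.++⁺ norep ([] AP.∷ AP.[]) (All.tabulate λ he → (λ m → old≠new he m) ∷ [])
      where
      old≠new : ∀ {e} → e ∈ˡ E → ¬ Match e (u , w)
      old≠new he (inj₁ (refl , _)) = u∉T (proj₁ (proj₂ (proj₁ (proj₂ tree) he)))
      old≠new he (inj₂ (_ , refl)) = u∉T (proj₂ (proj₂ (proj₁ (proj₂ tree) he)))
    continue : ∀ f → f + ∣ T ∣ ≡ ∣ D ∣ → ∃[ T' ] ∃[ E' ] (IsTreeIn G D T' E' × D ⊆ T' × NoRepeatedEdge E')
    continue zero    size = ⊥-elim (<⇒≱ (subst (_< ∣ insert u T ∣) size (≤-reflexive (≡-sym (∣insert∣ u T u∉T))))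
                                           (p⊆q⇒∣p∣≤∣q∣ (proj₁ tree')))
    continue (suc f) size = grow f (insert u T) (E ++ (u , w) ∷ [])
                              (trans (cong (f +_) (∣insert∣ u T u∉T)) (trans (+-suc f _) size))
                              tree' (insert-there u T v₀∈T) norep'

  root : IsTreeIn G D (insert v₀ ⊥) []
  root = insert-⊆ v₀∈D (λ h → ⊥-elim (∉⊥ h)) , (λ ()) , reach , ≡-sym (∣singleton∣ v₀)
    where
    reach : ∀ x y → x ∈ insert v₀ ⊥ → y ∈ insert v₀ ⊥ → ReachE [] x y
    reach x y hx hy with singleton-inv hx | singleton-inv hy
    ... | refl | refl = here

spanning-tree : ∀ (G : Graph n) (D : Subset n) → ConnectedOn G D →
  ∃[ T ] ∃[ E ] (IsTreeIn G D T E × D ⊆ T × NoRepeatedEdge E)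
spanning-tree G D ((v₀ , v₀∈D) , walk) =
  grow (∣ D ∣ ∸ 1) (insert v₀ ⊥) [] size root (insert-here v₀ ⊥) AP.[]
  where
  open SpanningTree G D v₀ v₀∈D walk
  size : ∣ D ∣ ∸ 1 + ∣ insert v₀ ⊥ ∣ ≡ ∣ D ∣
  size = trans (cong (∣ D ∣ ∸ 1 +_) (∣singleton∣ v₀))
               (m∸n+n≡m (subst (_≤ ∣ D ∣) (∣singleton∣ v₀) (p⊆q⇒∣p∣≤∣q∣ (proj₁ root))))

spanning-tree-size : ∀ {G : Graph n} {D T : Subset n} {E} → IsTreeIn G D T E → D ⊆ T → suc (length E) ≡ ∣ D ∣
spanning-tree-size (T⊆D , _ , _ , size) D⊆T = trans size (cong ∣_∣ (⊆-antisym T⊆D D⊆T))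

unique-map-transfer : ∀ {X Y Z : Set} (f : X → Y) (g : X → Z) xs → Unique (map g xs) →
  (∀ {x y} → x ∈ˡ xs → y ∈ˡ xs → f x ≡ f y → g x ≡ g y) → Unique (map f xs)
unique-map-transfer f g []       _       _ = []
unique-map-transfer f g (x ∷ xs) (x∉ ∷ u) reflect =
  head xs (λ z → z) x∉ ∷ unique-map-transfer f g xs u (λ hx hy → reflect (there hx) (there hy))
  where
  head : ∀ ys → (∀ {y} → y ∈ˡ ys → y ∈ˡ xs) → All (λ z → g x ≢ z) (map g ys) → All (λ z → f x ≢ z) (map f ys)
  head []       _    []       = []
  head (y ∷ ys) ys⊆xs (p ∷ ps) =
    (λ e → p (reflect (here refl) (there (ys⊆xs (here refl))) e)) ∷ head ys (λ z → ys⊆xs (there z)) ps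

colourOf : ∀ {A : Set} → (Fin n → Fin n → A) → Edge n → A
colourOf c e = c (proj₁ e) (proj₂ e)

Low High : ∀ {m} (p : ℕ) → Fin m → Set
Low  p c = toℕ c < p
High p c = p ≤ toℕ c

HighRainbowCover : ∀ {m} (G : Graph n) (D : Subset n) (k p : ℕ) (cD : Fin n → Fin n → Fin m) → Set
HighRainbowCover G D k p cD = ∀ S → S ⊆ D → ∣ S ∣ ≤ k →
  ∃[ T ] ∃[ E ] (IsTreeIn G D T E × S ⊆ T × Unique (map (colourOf cD) E) × All (High p) (map (colourOf cD) E))

-- Given S, a list A ⊆ D of at most k vertices
-- containing S ∩ D, and an attachable list L of leaf edges whose leaves are distinct vertices
-- outside D covering S ∖ D and whose colours are distinct and low, S lies in a rainbow tree
-- of G: a high-coloured rainbow tree of G[D] through A, with the leaves of L attached.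
rainbow-tree-from-leaves : ∀ {m} (G : Graph n) (k p : ℕ) (D : Subset n) (c : Fin n → Fin n → Fin m) →
  HighRainbowCover G D k p c →
  ∀ (S : Subset n) (A : List (Fin n)) (L : List (Edge n)) →
  All (_∈ D) A → length A ≤ k →
  (∀ {x} → x ∈ S → x ∈ D → x ∈ˡ A) → (∀ {x} → x ∈ S → x ∉ D → x ∈ˡ map proj₁ L) →
  All (λ e → proj₁ e ∉ D) L → Unique (map proj₁ L) → ParentsIn A L →
  All (λ e → Adj G (proj₁ e) (proj₂ e)) L → Unique (map (colourOf c) L) → All (Low p) (map (colourOf c) L) →
  ∃[ T ] ∃[ E ] (IsTreeIn G ⊤ T E × S ⊆ T × Unique (map (colourOf c) E))
rainbow-tree-from-leaves G k p D c cover S A L A⊆D ∣A∣≤k S∩D⊆A S∖D⊆L L∉D uL pL adjL ucL lowL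
  with cover (fromList A) (λ h → All.lookup A⊆D (fromList⁻ h)) (≤-trans (∣fromList∣≤ A) ∣A∣≤k)
... | T₀ , E₀ , (T₀⊆D , edges , reach , size) , A⊆T₀ , u₀ , high₀
  with add-leaves G ⊤ (colourOf c) L A T₀ E₀ ((λ _ → ∈⊤) , edges , reach , size) (λ h → A⊆T₀ (fromList⁺ h))
         (All.map (λ x∉D x∈T₀ → x∉D (T₀⊆D x∈T₀)) L∉D) uL pL adjL (All.universal (λ _ → ∈⊤) L) distinct
  where
  disjoint : ∀ {x} → ¬ (x ∈ˡ map (colourOf c) E₀ × x ∈ˡ map (colourOf c) L)
  disjoint (h₁ , h₂) = <⇒≱ (All.lookup lowL h₂) (All.lookup high₀ h₁)
  distinct : Unique (map (colourOf c) (E₀ ++ L))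
  distinct = subst Unique (≡-sym (map-++ (colourOf c) E₀ L)) (UniqueP.++⁺ u₀ ucL disjoint)
... | T , E , tree , T₀⊆T , L⊆T , u = T , E , tree , S⊆T , u
  where
  S⊆T : S ⊆ T
  S⊆T {x} x∈S with x ∈? D
  ... | yes x∈D = T₀⊆T (A⊆T₀ (fromList⁺ (S∩D⊆A x∈S x∈D)))
  ... | no  x∉D with ∈-map⁻ proj₁ (S∖D⊆L x∈S x∉D)
  ...   | e , e∈L , refl = All.lookup L⊆T e∈L

-- A k-rainbow colouring c of G[D], shifted up by p, is a high rainbow cover of G[D]
-- (a set of fewer than k vertices is first enlarged to exactly k vertices of D).
shifted-rainbow-cover : ∀ {q} (G : Graph n) (D : Subset n) (k p : ℕ) (c : Colouring G q) →
  IsKRainbowOn G D k c → k ≤ ∣ D ∣ → HighRainbowCover G D k p (λ u w → p ↑ʳ col c u w)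
shifted-rainbow-cover G D k p c rainbow k≤∣D∣ S S⊆D ∣S∣≤k with extend-to-size D S k S⊆D ∣S∣≤k k≤∣D∣
... | S' , S⊆S' , S'⊆D , ∣S'∣≡k with rainbow S' S'⊆D ∣S'∣≡k
... | T , E , tree , S'⊆T , distinct =
  T , E , tree , (λ h → S'⊆T (S⊆S' h)) ,
  subst Unique (≡-sym (map-∘ E)) (UniqueP.map⁺ (FP.↑ʳ-injective p _ _) distinct) ,
  AllP.map⁺ (All.universal high E)
  where
  high : ∀ e → High p (p ↑ʳ col c (proj₁ e) (proj₂ e))
  high e = subst (p ≤_) (≡-sym (FP.toℕ-↑ʳ p _)) (m≤m+n p _)

edgeIndex : (E : List (Edge n)) → Fin n → Fin n → Maybe (Fin (length E))
edgeIndex []      u w = nothing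
edgeIndex (e ∷ E) u w with match? e (u , w)
... | yes _ = just zero
... | no  _ = Maybe.map suc (edgeIndex E u w)

edgeIndex-sym : ∀ (E : List (Edge n)) u w → edgeIndex E u w ≡ edgeIndex E w u
edgeIndex-sym []      u w = refl
edgeIndex-sym (e ∷ E) u w with match? e (u , w) | match? e (w , u)
... | yes _ | yes _  = refl
... | yes m | no ¬m  = ⊥-elim (¬m (match-flip e m))
... | no ¬m | yes m  = ⊥-elim (¬m (match-flip e m))
... | no _  | no _   = cong (Maybe.map suc) (edgeIndex-sym E u w)

edgeIndex-∈ : ∀ (E : List (Edge n)) {e} → e ∈ˡ E → ∃[ i ] (colourOf (edgeIndex E) e ≡ just i)
edgeIndex-∈ (e' ∷ E) {e} h with match? e' e
... | yes _ = zero , refl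
edgeIndex-∈ (e' ∷ E) {e} (here refl) | no ¬m = ⊥-elim (¬m (match-refl e))
edgeIndex-∈ (e' ∷ E) {e} (there h)   | no ¬m with edgeIndex-∈ E h
... | i , eq = suc i , cong (Maybe.map suc) eq

edgeIndex-head : ∀ (e : Edge n) E → colourOf (edgeIndex (e ∷ E)) e ≡ just zero
edgeIndex-head e E with match? e e
... | yes _  = refl
... | no ¬m  = ⊥-elim (¬m (match-refl e))

edgeIndex-tail : ∀ (e' : Edge n) E {e} → ¬ Match e' e →
  colourOf (edgeIndex (e' ∷ E)) e ≡ Maybe.map suc (colourOf (edgeIndex E) e)
edgeIndex-tail e' E {e} ¬m with match? e' e
... | yes m = ⊥-elim (¬m m)
... | no _  = refl

edgeIndex-unique : ∀ (E : List (Edge n)) → NoRepeatedEdge E → Unique (map (colourOf (edgeIndex E)) E)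
edgeIndex-unique []      AP.[]            = []
edgeIndex-unique (e ∷ E) (e≁E AP.∷ norep) = head ∷ tail
  where
  shifted : ∀ {x} → x ∈ˡ E → colourOf (edgeIndex (e ∷ E)) x ≡ Maybe.map suc (colourOf (edgeIndex E) x)
  shifted hx = edgeIndex-tail e E (All.lookup e≁E hx)
  not-zero : ∀ {m} (z : Maybe (Fin m)) → Maybe.map (Fin.suc {m}) z ≢ just Fin.zero
  not-zero (just _) ()
  not-zero nothing  ()
  head : All (λ z → colourOf (edgeIndex (e ∷ E)) e ≢ z) (map (colourOf (edgeIndex (e ∷ E))) E)
  head = AllP.map⁺ (All.tabulate (λ {x} hx eq →
           not-zero (colourOf (edgeIndex E) x) (trans (≡-sym (shifted hx)) (trans (≡-sym eq) (edgeIndex-head e E)))))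
  tail : Unique (map (colourOf (edgeIndex (e ∷ E))) E)
  tail = unique-map-transfer (colourOf (edgeIndex (e ∷ E))) (colourOf (edgeIndex E)) E (edgeIndex-unique E norep)
           (λ hx hy eq → maybe-map-injective FP.suc-injective (trans (≡-sym (shifted hx)) (trans eq (shifted hy))))

-- Colouring the edges of a spanning tree E of G[D] by their positions, shifted up by p
-- (other pairs get an arbitrary colour d): a high rainbow cover of G[D] for every k.
treeColouring : ∀ (p : ℕ) (E : List (Edge n)) → Fin (p + length E) → Fin n → Fin n → Fin (p + length E)
treeColouring p E d u w = maybe (p ↑ʳ_) d (edgeIndex E u w)

treeColouring-sym : ∀ p (E : List (Edge n)) d u w → treeColouring p E d u w ≡ treeColouring p E d w u
treeColouring-sym p E d u w = cong (maybe (p ↑ʳ_) d) (edgeIndex-sym E u w)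

spanning-tree-cover : ∀ (G : Graph n) (D : Subset n) T (E : List (Edge n)) (p k : ℕ) d →
  IsTreeIn G D T E → D ⊆ T → NoRepeatedEdge E → HighRainbowCover G D k p (treeColouring p E d)
spanning-tree-cover G D T E p k d tree D⊆T norep S S⊆D _ =
  T , E , tree , (λ h → D⊆T (S⊆D h)) , distinct , AllP.map⁺ (All.tabulate high)
  where
  positioned : ∀ {e} → e ∈ˡ E → ∃[ i ] (colourOf (edgeIndex E) e ≡ just i × colourOf (treeColouring p E d) e ≡ p ↑ʳ i)
  positioned {e} h with edgeIndex-∈ E h
  ... | i , eq = i , eq , cong (maybe (p ↑ʳ_) d) eq
  distinct : Unique (map (colourOf (treeColouring p E d)) E)
  distinct = unique-map-transfer _ (colourOf (edgeIndex E)) E (edgeIndex-unique E norep) same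
    where
    same : ∀ {x y} → x ∈ˡ E → y ∈ˡ E → colourOf (treeColouring p E d) x ≡ colourOf (treeColouring p E d) y →
      colourOf (edgeIndex E) x ≡ colourOf (edgeIndex E) y
    same hx hy eq with positioned hx | positioned hy
    ... | i , ix , cx | j , jy , cy =
      trans ix (trans (cong just (FP.↑ʳ-injective p i j (trans (≡-sym cx) (trans eq cy)))) (≡-sym jy))
  high : ∀ {e} → e ∈ˡ E → High p (colourOf (treeColouring p E d) e)
  high h with positioned h
  ... | i , _ , c = subst (λ z → p ≤ toℕ z) (≡-sym c) (subst (p ≤_) (≡-sym (FP.toℕ-↑ʳ p i)) (m≤m+n p _))

nth : List (Fin n) → ℕ → Fin n → Fin n
nth []       _       d = d
nth (x ∷ xs) zero    d = x
nth (x ∷ xs) (suc j) d = nth xs j d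

nth-∈ : ∀ (xs : List (Fin n)) j d → j < length xs → nth xs j d ∈ˡ xs
nth-∈ (x ∷ xs) zero    d _         = here refl
nth-∈ (x ∷ xs) (suc j) d (s≤s j<) = there (nth-∈ xs j d j<)

position : Fin n → List (Fin n) → ℕ
position x []       = zero
position x (y ∷ ys) with x FP.≟ y
... | yes _ = zero
... | no  _ = suc (position x ys)

position-nth : ∀ (xs : List (Fin n)) j d → Unique xs → j < length xs → position (nth xs j d) xs ≡ j
position-nth (x ∷ xs) zero    d u lt with x FP.≟ x
... | yes _ = refl
... | no ne = ⊥-elim (ne refl)
position-nth (x ∷ xs) (suc j) d (x∉ ∷ u) (s≤s lt) with nth xs j d FP.≟ x
... | yes e = ⊥-elim (AllP.All¬⇒¬Any x∉ (subst (_∈ˡ xs) e (nth-∈ xs j d lt)))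
... | no  _ = cong suc (position-nth xs j d u lt)

clamp : ∀ m → ℕ → Fin (suc m)
clamp m       zero    = zero
clamp zero    (suc j) = zero
clamp (suc m) (suc j) = suc (clamp m j)

toℕ-clamp : ∀ m j → j ≤ m → toℕ (clamp m j) ≡ j
toℕ-clamp m       zero    _        = refl
toℕ-clamp (suc m) (suc j) (s≤s le) = cong suc (toℕ-clamp m j le)

clamp-toℕ : ∀ m (i : Fin (suc m)) → clamp m (toℕ i) ≡ i
clamp-toℕ m       zero    = refl
clamp-toℕ (suc m) (suc i) = cong suc (clamp-toℕ m i)

range : ℕ → ℕ → List ℕ
range j zero    = []
range j (suc l) = j ∷ range (suc j) l

range-bounds : ∀ j l {i} → i ∈ˡ range j l → j ≤ i × i < j + l
range-bounds j (suc l) (here refl) = ≤-refl , subst (j <_) (≡-sym (+-suc j l)) (s≤s (m≤m+n j l))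
range-bounds j (suc l) {i} (there h) =
  let (j<i , i<) = range-bounds (suc j) l h in ≤-trans (n≤1+n j) j<i , subst (i <_) (≡-sym (+-suc j l)) i<

range-unique : ∀ j l → Unique (range j l)
range-unique j zero    = []
range-unique j (suc l) = All.tabulate (λ h e → <-irrefl e (proj₁ (range-bounds (suc j) l h))) ∷ range-unique (suc j) l

range-map-unique : ∀ {A : Set} (f : ℕ → A) b l → l ≤ b →
  (∀ {i j} → i < b → j < b → f i ≡ f j → i ≡ j) → Unique (map f (range 0 l))
range-map-unique f b l l≤b f-inj =
  unique-map-transfer f (λ i → i) (range 0 l) (subst Unique (≡-sym (map-id _)) (range-unique 0 l))
    (λ hi hj → f-inj (below hi) (below hj))
  where
  below : ∀ {i} → i ∈ˡ range 0 l → i < b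
  below h = ≤-trans (proj₂ (range-bounds 0 l h)) l≤b

record Partition {A : Set} (P : Pred A 0ℓ) (xs : List A) : Set where
  field
    yes-part no-part : List A
    yes-all  : All P yes-part
    no-all   : All (λ x → ¬ P x) no-part
    yes-⊆    : ∀ {x} → x ∈ˡ yes-part → x ∈ˡ xs
    no-⊆     : ∀ {x} → x ∈ˡ no-part → x ∈ˡ xs
    yes-cover : ∀ {x} → x ∈ˡ xs → P x → x ∈ˡ yes-part
    no-cover  : ∀ {x} → x ∈ˡ xs → ¬ P x → x ∈ˡ no-part
    yes-unique : Unique yes-part
    no-unique  : Unique no-part
    sizes    : length yes-part + length no-part ≡ length xs

partition : ∀ {A : Set} {P : Pred A 0ℓ} (P? : Decidable P) xs → Unique xs → Partition P xs
partition {P = P} P? xs u = record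
  { yes-part = filter P? xs ; no-part = filter (λ x → ¬? (P? x)) xs
  ; yes-all = All.tabulate (λ h → proj₂ (∈-filter⁻ P? {xs = xs} h))
  ; no-all  = All.tabulate (λ h → proj₂ (∈-filter⁻ (λ x → ¬? (P? x)) {xs = xs} h))
  ; yes-⊆ = λ h → proj₁ (∈-filter⁻ P? {xs = xs} h)
  ; no-⊆  = λ h → proj₁ (∈-filter⁻ (λ x → ¬? (P? x)) {xs = xs} h)
  ; yes-cover = ∈-filter⁺ P?
  ; no-cover  = ∈-filter⁺ (λ x → ¬? (P? x))
  ; yes-unique = UniqueP.filter⁺ P? u
  ; no-unique  = UniqueP.filter⁺ (λ x → ¬? (P? x)) u
  ; sizes = sizes xs }
  where
  sizes : ∀ xs → length (filter P? xs) + length (filter (λ x → ¬? (P? x)) xs) ≡ length xs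
  sizes []       = refl
  sizes (x ∷ xs) with P? x
  ... | yes _ = cong suc (sizes xs)
  ... | no  _ = trans (+-suc _ _) (cong suc (sizes xs))

neighboursIn : Graph n → Subset n → Fin n → List (Fin n)
neighboursIn G D v = toList (nbrs G v ∩ D)

neighbour-adj : ∀ (G : Graph n) {v x} → x ∈ nbrs G v → Adj G v x
neighbour-adj G {v} {x} h = trans (≡-sym (lookup∘tabulate (adj G v) x)) ([]=⇒lookup h)

neighboursIn-adj : ∀ (G : Graph n) D {v x} → x ∈ˡ neighboursIn G D v → Adj G v x × x ∈ D
neighboursIn-adj G D {v} h = let (x∈N , x∈D) = x∈p∩q⁻ (nbrs G v) D (toList⁻ h) in neighbour-adj G x∈N , x∈D

PendantIn : Graph n → Subset n → Edge n → Set
PendantIn G D e = Adj G (proj₁ e) (proj₂ e) × proj₂ e ∈ D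

adj-≢ : ∀ (G : Graph n) {x w} → Adj G x w → x ≢ w
adj-≢ G {x} x~x refl with trans (≡-sym x~x) (irref G x)
... | ()

-- Colours below p are low, the rest high:
--   • an edge inside D gets its colour C from a high rainbow cover of G[D];
--   • an edge from v ∉ D to its i-th neighbour in D gets the low colour label v i;
--   • an edge outside D gets the low colour outer.
module PendantColouring (G : Graph n) (D : Subset n) (δ : ℕ) (dom : IsDominating G δ D)
  {p q : ℕ} (C : Fin n → Fin n → Fin (p + q)) (C-sym : ∀ u w → C u w ≡ C w u)
  (label : Fin n → ℕ → Fin p) (outer : Fin p) where

  N : Fin n → Fin n → Fin (p + q)
  N u w with u ∈? D | w ∈? D
  ... | yes _ | yes _ = C u w
  ... | no  _ | yes _ = label u (position w (neighboursIn G D u)) ↑ˡ q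
  ... | yes _ | no  _ = label w (position u (neighboursIn G D w)) ↑ˡ q
  ... | no  _ | no  _ = outer ↑ˡ q

  N-sym : ∀ u w → N u w ≡ N w u
  N-sym u w with u ∈? D | w ∈? D
  ... | yes _ | yes _ = C-sym u w
  ... | no  _ | yes _ = refl
  ... | yes _ | no  _ = refl
  ... | no  _ | no  _ = refl

  colouring : Colouring G (p + q)
  colouring = record { col = N ; colSym = N-sym }

  N-inside : ∀ {u w} → u ∈ D → w ∈ D → N u w ≡ C u w
  N-inside {u} {w} u∈D w∈D with u ∈? D | w ∈? D
  ... | yes _  | yes _  = refl
  ... | no u∉D | _      = ⊥-elim (u∉D u∈D)
  ... | _      | no w∉D = ⊥-elim (w∉D w∈D)

  N-outside : ∀ {v w} → v ∉ D → w ∉ D → N v w ≡ outer ↑ˡ q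
  N-outside {v} {w} v∉D w∉D with v ∈? D | w ∈? D
  ... | no _     | no _     = refl
  ... | yes v∈D  | _        = ⊥-elim (v∉D v∈D)
  ... | _        | yes w∈D  = ⊥-elim (w∉D w∈D)

  pendant-colour : ∀ {v} j → v ∉ D → j < length (neighboursIn G D v) →
    N v (nth (neighboursIn G D v) j v) ≡ label v j ↑ˡ q
  pendant-colour {v} j v∉D j< with v ∈? D | nth (neighboursIn G D v) j v ∈? D
  ... | no _    | yes _   = cong (λ i → label v i ↑ˡ q)
                                 (position-nth (neighboursIn G D v) j v (toList-unique (nbrs G v ∩ D)) j<)
  ... | yes v∈D | _       = ⊥-elim (v∉D v∈D)
  ... | _       | no d∉D  = ⊥-elim (d∉D (proj₂ (neighboursIn-adj G D (nth-∈ (neighboursIn G D v) j v j<))))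

  low : ∀ (x : Fin p) → Low p (x ↑ˡ q)
  low x = subst (_< p) (≡-sym (FP.toℕ-↑ˡ x q)) (FP.toℕ<n x)

  -- N agrees with C inside D, so it inherits the high rainbow cover.
  high-cover : ∀ {k} → HighRainbowCover G D k p C → HighRainbowCover G D k p N
  high-cover cover S S⊆D ∣S∣≤k with cover S S⊆D ∣S∣≤k
  ... | T , E , tree , S⊆T , distinct , high =
    T , E , tree , S⊆T ,
    unique-map-transfer (colourOf N) (colourOf C) E distinct (λ hx hy e → trans (≡-sym (agree hx)) (trans e (agree hy))) ,
    AllP.map⁺ (All.tabulate (λ {e} h → subst (High p) (≡-sym (agree h)) (All.lookup (AllP.map⁻ high) h)))
    where
    agree : ∀ {e} → e ∈ˡ E → colourOf N e ≡ colourOf C e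
    agree h = let (_ , u∈T , w∈T) = proj₁ (proj₂ tree) h in N-inside (proj₁ tree u∈T) (proj₁ tree w∈T)

  -- Hanging the vertices vs (outside D) on D: the i-th vertex of vs is joined to its
  -- (j+i)-th neighbour in D; this exists as long as j + |vs| ≤ δ.
  pendantEdges : ℕ → List (Fin n) → List (Edge n)
  pendantEdges j []       = []
  pendantEdges j (v ∷ vs) = (v , nth (neighboursIn G D v) j v) ∷ pendantEdges (suc j) vs

  pendantEdges-leaves : ∀ j vs → map proj₁ (pendantEdges j vs) ≡ vs
  pendantEdges-leaves j []       = refl
  pendantEdges-leaves j (v ∷ vs) = cong (v ∷_) (pendantEdges-leaves (suc j) vs)

  length-pendantEdges : ∀ j vs → length (pendantEdges j vs) ≡ length vs
  length-pendantEdges j []       = refl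
  length-pendantEdges j (v ∷ vs) = cong suc (length-pendantEdges (suc j) vs)

  private
    next-bound : ∀ j (vs : List (Fin n)) {b} → j + suc (length vs) ≤ b → suc j + length vs ≤ b
    next-bound j vs {b} le = subst (_≤ b) (+-suc j (length vs)) le

    index-ok : ∀ j v vs → v ∉ D → j + length (v ∷ vs) ≤ δ → j < length (neighboursIn G D v)
    index-ok j v vs v∉D le = ≤-trans (≤-trans (m≤m+n (suc j) (length vs)) (next-bound j vs le))
                               (subst (δ ≤_) (≡-sym (length-toList (nbrs G v ∩ D))) (dom v v∉D))

  pendantEdges-valid : ∀ j vs → All (_∉ D) vs → j + length vs ≤ δ → All (PendantIn G D) (pendantEdges j vs)
  pendantEdges-valid j []       _            _  = []
  pendantEdges-valid j (v ∷ vs) (v∉D ∷ vs∉D) le =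
    neighboursIn-adj G D (nth-∈ (neighboursIn G D v) j v (index-ok j v vs v∉D le))
    ∷ pendantEdges-valid (suc j) vs vs∉D (next-bound j vs le)

  pendantEdges-colours : ∀ (ℓ : ℕ → Fin p) j vs → All (λ v → ∀ i → label v i ≡ ℓ i) vs → All (_∉ D) vs →
    j + length vs ≤ δ → map (colourOf N) (pendantEdges j vs) ≡ map (λ i → ℓ i ↑ˡ q) (range j (length vs))
  pendantEdges-colours ℓ j []       _            _            _  = refl
  pendantEdges-colours ℓ j (v ∷ vs) (same ∷ sames) (v∉D ∷ vs∉D) le =
    cong₂ _∷_ (trans (pendant-colour j v∉D (index-ok j v vs v∉D le)) (cong (_↑ˡ q) (same j)))
              (pendantEdges-colours ℓ (suc j) vs sames vs∉D (next-bound j vs le))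

  pendantEdges-attachable : ∀ A j vs → (∀ {x} → x ∈ˡ map proj₂ (pendantEdges j vs) → x ∈ˡ A) →
    ParentsIn A (pendantEdges j vs)
  pendantEdges-attachable A j vs parents⊆A =
    parentsIn-start A (pendantEdges j vs) (All.tabulate (λ h → parents⊆A (∈-map⁺ proj₂ h)))

  pendantEdges-outside : ∀ j vs → All (_∉ D) vs → All (λ e → proj₁ e ∉ D) (pendantEdges j vs)
  pendantEdges-outside j vs vs∉D = AllP.map⁻ (subst (All (_∉ D)) (≡-sym (pendantEdges-leaves j vs)) vs∉D)

  pendantEdges-unique : ∀ j vs → Unique vs → Unique (map proj₁ (pendantEdges j vs))
  pendantEdges-unique j vs u = subst Unique (≡-sym (pendantEdges-leaves j vs)) u

Construction : Graph n → Subset n → ℕ → ℕ → Set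
Construction G D k p = ∀ {q} (C : _ → _ → Fin (p + q)) → (∀ u w → C u w ≡ C w u) →
  HighRainbowCover G D k p C → Σ (Colouring G (p + q)) (IsKRainbowOn G ⊤ k)

-- If D is k-dominating (k = suc k₀) and C is a high rainbow cover of G[D] with
-- colours ≥ k, then G has a k-rainbow colouring with the k + q colours of C: the i-th
-- vertex of S ∖ D is hung on its i-th neighbour in D with colour i.
part-one-colouring : ∀ (G : Graph n) k₀ (D : Subset n) → IsDominating G (suc k₀) D →
  Construction G D (suc k₀) (suc k₀)
part-one-colouring {n} G k₀ D dom {q} C C-sym cover = colouring , rainbow
  where
  k : ℕ
  k = suc k₀
  open PendantColouring G D k dom C C-sym (λ _ i → clamp k₀ i) zero

  clamp-injective : ∀ {i j} → i < k → j < k → clamp k₀ i ↑ˡ q ≡ clamp k₀ j ↑ˡ q → i ≡ j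
  clamp-injective {i} {j} i<k j<k e = trans (≡-sym (toℕ-clamp k₀ i (≤-pred i<k)))
                                        (trans (cong toℕ (FP.↑ˡ-injective q _ _ e)) (toℕ-clamp k₀ j (≤-pred j<k)))

  rainbow : IsKRainbowOn G ⊤ k colouring
  rainbow S _ ∣S∣≡k = rainbow-tree-from-leaves G k k D N (high-cover cover) S A L
                        A⊆D ∣A∣≤k S∩D⊆A S∖D⊆L (pendantEdges-outside 0 vs no-all) (pendantEdges-unique 0 vs no-unique)
                        (pendantEdges-attachable A 0 vs (∈-++⁺ʳ yes-part)) (All.map proj₁ valid) distinct lowL
    where
    open Partition (partition (_∈? D) (toList S) (toList-unique S))
    vs : List (Fin n)
    vs = no-part
    L : List (Edge n)
    L = pendantEdges 0 vs
    A : List (Fin n)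
    A = yes-part ++ map proj₂ L
    sizes-k : length yes-part + length vs ≡ k
    sizes-k = trans sizes (trans (length-toList S) ∣S∣≡k)
    vs≤k : 0 + length vs ≤ k
    vs≤k = subst (length vs ≤_) sizes-k (m≤n+m _ _)
    valid : All (PendantIn G D) L
    valid = pendantEdges-valid 0 vs no-all vs≤k
    colours : map (colourOf N) L ≡ map (λ i → clamp k₀ i ↑ˡ q) (range 0 (length vs))
    colours = pendantEdges-colours (clamp k₀) 0 vs (All.universal (λ _ _ → refl) vs) no-all vs≤k
    A⊆D : All (_∈ D) A
    A⊆D = AllP.++⁺ yes-all (AllP.map⁺ (All.map proj₂ valid))
    ∣A∣≤k : length A ≤ k
    ∣A∣≤k = ≤-reflexive (trans (length-++ yes-part)
                           (trans (cong (length yes-part +_) (trans (length-map proj₂ L) (length-pendantEdges 0 vs))) sizes-k))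
    S∩D⊆A : ∀ {x} → x ∈ S → x ∈ D → x ∈ˡ A
    S∩D⊆A x∈S x∈D = ∈-++⁺ˡ (yes-cover (toList⁺ x∈S) x∈D)
    S∖D⊆L : ∀ {x} → x ∈ S → x ∉ D → x ∈ˡ map proj₁ L
    S∖D⊆L x∈S x∉D = subst (_ ∈ˡ_) (≡-sym (pendantEdges-leaves 0 vs)) (no-cover (toList⁺ x∈S) x∉D)
    distinct : Unique (map (colourOf N) L)
    distinct = subst Unique (≡-sym colours) (range-map-unique _ k (length vs) vs≤k clamp-injective)
    lowL : All (Low k) (map (colourOf N) L)
    lowL = subst (All (Low k)) (≡-sym colours) (AllP.map⁺ (All.universal (λ i → low (clamp k₀ i)) _))

-- For a labelling m : V → Bool, a vertex x ∉ D that is not full is good if it has a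
-- neighbour w ∉ D that is full or carries the other label. A labelling making every such
-- vertex good exists: flipping the label of a bad vertex u makes u good (u has a neighbour
-- outside D, all with u's old label) and creates no new bad vertex, so the number of bad
-- vertices strictly decreases.
module Labelling (G : Graph n) (k : ℕ) (D : Subset n) (mindeg : MinDegree≥ G k) where

  Full : Fin n → Set
  Full v = k ≤ ∣ nbrs G v ∩ D ∣

  Full? : ∀ v → Dec (Full v)
  Full? v = k ≤? ∣ nbrs G v ∩ D ∣

  Good : (Fin n → Bool) → Fin n → Set
  Good m x = ∃[ w ] (Adj G x w × w ∉ D × (Full w ⊎ m w ≢ m x))

  Good? : ∀ m x → Dec (Good m x)
  Good? m x = FP.any? (λ w → (adj G x w Bool.≟ true) ×-dec ¬? (w ∈? D) ×-dec (Full? w ⊎-dec ¬? (m w Bool.≟ m x)))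

  Bad : (Fin n → Bool) → Fin n → Set
  Bad m x = x ∉ D × ¬ Full x × ¬ Good m x

  Bad? : ∀ m x → Dec (Bad m x)
  Bad? m x = ¬? (x ∈? D) ×-dec ¬? (Full? x) ×-dec ¬? (Good? m x)

  -- A vertex that is not full has a neighbour outside D (since its degree is ≥ k).
  outside-neighbour : ∀ x → ¬ Full x → ∃[ w ] (Adj G x w × w ∉ D)
  outside-neighbour x not-full with ∃-new-element (nbrs G x ∩ D) (nbrs G x) (≤-trans (≰⇒> not-full) (mindeg x))
  ... | w , w∈N , w∉N∩D = w , neighbour-adj G w∈N , λ w∈D → w∉N∩D (x∈p∩q⁺ (w∈N , w∈D))

  badSet : (Fin n → Bool) → Subset n
  badSet m = tabulate (λ x → does (Bad? m x))

  badSet⁺ : ∀ m x → Bad m x → x ∈ badSet m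
  badSet⁺ m x bad = lookup⇒[]= x (badSet m) (trans (lookup∘tabulate _ x) (dec-true (Bad? m x) bad))

  badSet⁻ : ∀ m x → x ∈ badSet m → Bad m x
  badSet⁻ m x h = yes-of (Bad? m x) (trans (≡-sym (lookup∘tabulate _ x)) ([]=⇒lookup h))
    where
    yes-of : ∀ {A : Set} (d : Dec A) → does d ≡ true → A
    yes-of (yes a) _ = a
    yes-of (no _)  ()

  flip-at : (Fin n → Bool) → Fin n → Fin n → Bool
  flip-at m u x with x FP.≟ u
  ... | yes _ = not (m x)
  ... | no  _ = m x

  flip-at-here : ∀ m u → flip-at m u u ≡ not (m u)
  flip-at-here m u with u FP.≟ u
  ... | yes _ = refl
  ... | no ne = ⊥-elim (ne refl)

  flip-at-other : ∀ m u x → x ≢ u → flip-at m u x ≡ m x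
  flip-at-other m u x x≢u with x FP.≟ u
  ... | yes e = ⊥-elim (x≢u e)
  ... | no  _ = refl

  not-≢ : ∀ b → not b ≢ b
  not-≢ true  ()
  not-≢ false ()

  bad-neighbour : ∀ m u → Bad m u → ∀ w → Adj G u w → w ∉ D → ¬ Full w × m w ≡ m u
  bad-neighbour m u (_ , _ , not-good) w u~w w∉D =
    (λ full → not-good (w , u~w , w∉D , inj₁ full)) ,
    decidable-stable (m w Bool.≟ m u) (λ ne → not-good (w , u~w , w∉D , inj₂ ne))

  bad-after-flip : ∀ m u x → Bad m u → Bad (flip-at m u) x → Bad m x × x ≢ u
  bad-after-flip m u x bad-u (x∉D , not-full , not-good) = by-cases (x FP.≟ u)
    where
    -- u itself became good: a neighbour outside D kept the old label of u
    by-cases : Dec (x ≡ u) → Bad m x × x ≢ u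
    by-cases (yes refl) with outside-neighbour x not-full
    ... | w , x~w , w∉D = ⊥-elim (not-good (w , x~w , w∉D , inj₂ differ))
      where
      differ : flip-at m x w ≢ flip-at m x x
      differ e = not-≢ (m x) (≡-sym (trans (≡-sym (proj₂ (bad-neighbour m x bad-u w x~w w∉D)))
                   (trans (≡-sym (flip-at-other m x w (λ w≡x → adj-≢ G x~w (≡-sym w≡x)))) (trans e (flip-at-here m x)))))
    -- another vertex: flipping u only matters if u is its neighbour, and then u had x's label
    by-cases (no x≢u) = (x∉D , not-full , not-good-before) , x≢u
      where
      not-good-before : ¬ Good m x
      not-good-before (w , x~w , w∉D , inj₁ full) = not-good (w , x~w , w∉D , inj₁ full)
      not-good-before (w , x~w , w∉D , inj₂ ne) with w FP.≟ u
      ... | yes refl = ne (≡-sym (proj₂ (bad-neighbour m w bad-u x (trans (Graph.sym G w x) x~w) x∉D)))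
      ... | no  w≢u  = not-good (w , x~w , w∉D , inj₂ (λ e → ne (trans (≡-sym (flip-at-other m u w w≢u))
                                                                     (trans e (flip-at-other m u x x≢u)))))

  flip-decreases : ∀ m u → Bad m u → ∣ badSet (flip-at m u) ∣ < ∣ badSet m ∣
  flip-decreases m u bad-u = ≤-<-trans (p⊆q⇒∣p∣≤∣q∣ shrink) (x∈p⇒∣p-x∣<∣p∣ (badSet⁺ m u bad-u))
    where
    shrink : badSet (flip-at m u) ⊆ badSet m - u
    shrink {x} h = let (bad-x , x≢u) = bad-after-flip m u x bad-u (badSet⁻ (flip-at m u) x h)
                   in x∈p∧x≢y⇒x∈p-y (badSet⁺ m x bad-x) x≢u

  private
    search : ∀ f m → ∣ badSet m ∣ ≤ f → ∃[ m' ] (∀ x → x ∉ D → ¬ Full x → Good m' x)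
    search f m bound with FP.any? (Bad? m)
    ... | no none = m , λ x x∉D not-full → decidable-stable (Good? m x) (λ ng → none (x , x∉D , not-full , ng))
    search zero    m bound | yes (u , bad-u) = ⊥-elim (<⇒≱ (≤-<-trans z≤n (x∈p⇒∣p-x∣<∣p∣ (badSet⁺ m u bad-u))) bound)
    search (suc f) m bound | yes (u , bad-u) = search f (flip-at m u) (≤-pred (<-≤-trans (flip-decreases m u bad-u) bound))

  good-labelling : ∃[ m ] (∀ x → x ∉ D → ¬ Full x → Good m x)
  good-labelling = search _ (λ _ → false) ≤-refl

orient : ∀ {k} → Bool → Fin k → Fin k
orient false i = i
orient true  i = opposite i

orient-involutive : ∀ {k} b (i : Fin k) → orient b (orient b i) ≡ i
orient-involutive false i = refl
orient-involutive true  i = FP.opposite-involutive i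

-- D is (k-1)-dominating (k = suc δ, δ = suc k₁), δ(G) ≥ k, and C is a high rainbow
-- cover of G[D] with colours ≥ k + 1. Low colours: 0, …, k-1 on pendant edges, where a vertex
-- labelled b numbers its D-neighbours upwards (b = false) or downwards (b = true), and the
-- colour k ("star") on edges outside D.
module PartTwo (G : Graph n) (k₁ : ℕ) (D : Subset n) (dom : IsDominating G (suc k₁) D)
  (mindeg : MinDegree≥ G (suc (suc k₁))) {q : ℕ}
  (C : Fin n → Fin n → Fin (suc (suc (suc k₁)) + q)) (C-sym : ∀ u w → C u w ≡ C w u)
  (cover : HighRainbowCover G D (suc (suc k₁)) (suc (suc (suc k₁))) C) where

  δ k : ℕ
  δ = suc k₁
  k = suc δ

  open Labelling G k D mindeg

  m : Fin n → Bool
  m = proj₁ good-labelling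

  good : ∀ x → x ∉ D → ¬ Full x → Good m x
  good = proj₂ good-labelling

  labelColour : Bool → ℕ → Fin (suc k)
  labelColour b i = inject₁ (orient b (clamp δ i))

  open PendantColouring G D δ dom C C-sym (λ v → labelColour (m v)) (fromℕ k)

  colour : Bool → ℕ → Fin (suc k + q)
  colour b i = labelColour b i ↑ˡ q

  star : Fin (suc k + q)
  star = fromℕ k ↑ˡ q

  toℕ-colour : ∀ b i → toℕ (colour b i) ≡ toℕ (orient b (clamp δ i))
  toℕ-colour b i = trans (FP.toℕ-↑ˡ _ q) (FP.toℕ-inject₁ _)

  toℕ-star : toℕ star ≡ k
  toℕ-star = trans (FP.toℕ-↑ˡ (fromℕ k) q) (FP.toℕ-fromℕ k)

  colour≢star : ∀ b i → colour b i ≢ star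
  colour≢star b i e = <-irrefl refl (subst (_< k) (trans (≡-sym (toℕ-colour b i)) (trans (cong toℕ e) toℕ-star))
                                                  (FP.toℕ<n (orient b (clamp δ i))))

  colour-injective : ∀ b {i j} → i < k → j < k → colour b i ≡ colour b j → i ≡ j
  colour-injective b {i} {j} i<k j<k e =
    trans (≡-sym (toℕ-clamp δ i (≤-pred i<k))) (trans (cong toℕ same) (toℕ-clamp δ j (≤-pred j<k)))
    where
    same : clamp δ i ≡ clamp δ j
    same = trans (≡-sym (orient-involutive b _))
             (trans (cong (orient b) (FP.inject₁-injective (FP.↑ˡ-injective q _ _ e))) (orient-involutive b _))

  colour-up : ∀ i → i < k → toℕ (colour false i) ≡ i
  colour-up i i<k = trans (toℕ-colour false i) (toℕ-clamp δ i (≤-pred i<k))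

  colour-down : ∀ i → i < k → toℕ (colour true i) ≡ k ∸ suc i
  colour-down i i<k = trans (toℕ-colour true i)
    (trans (FP.opposite-prop (clamp δ i)) (cong (λ z → k ∸ suc z) (toℕ-clamp δ i (≤-pred i<k))))

  low-colour : ∀ b i → Low (suc k) (colour b i)
  low-colour b i = low (labelColour b i)

  low-star : Low (suc k) star
  low-star = low (fromℕ k)

  last : Bool → Fin (suc k + q)
  last b = colour b δ

  colour≢last : ∀ b i → i < δ → colour b i ≢ last b
  colour≢last b i i<δ e = <-irrefl (colour-injective b (≤-trans i<δ (n≤1+n _)) ≤-refl e) i<δ

  up≢down : ∀ {a c i j} → a + c ≤ k → i < a → j < c → colour false i ≢ colour true j
  up≢down {a} {c} {i} {j} a+c≤k i<a j<c e = <-irrefl sum≡k sum<k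
    where
    j<k : j < k
    j<k = ≤-trans j<c (≤-trans (m≤n+m c a) a+c≤k)
    i≡ : i ≡ k ∸ suc j
    i≡ = trans (≡-sym (colour-up i (≤-trans i<a (≤-trans (m≤m+n a c) a+c≤k))))
           (trans (cong toℕ e) (colour-down j j<k))
    sum≡k : i + suc j ≡ k
    sum≡k = trans (cong (_+ suc j) i≡) (m∸n+n≡m j<k)
    sum<k : i + suc j < k
    sum<k = ≤-trans (+-mono-≤ i<a j<c) a+c≤k

  first-colours-then : ∀ b ys → Unique ys → All (λ y → ∀ i → i < δ → colour b i ≢ y) ys →
    Unique (map (colour b) (range 0 δ) ++ ys)
  first-colours-then b ys u-ys new = UniqueP.++⁺ (range-map-unique (colour b) k δ (n≤1+n δ) (colour-injective b)) u-ys apart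
    where
    apart : ∀ {c} → ¬ (c ∈ˡ map (colour b) (range 0 δ) × c ∈ˡ ys)
    apart (h₁ , h₂) with ∈-map⁻ (colour b) h₁
    ... | i , i∈ , refl = All.lookup new h₂ i (proj₂ (range-bounds 0 δ i∈)) refl

  RainbowTreeThrough : Subset n → Set
  RainbowTreeThrough S = ∃[ T ] ∃[ E ] (IsTreeIn G ⊤ T E × S ⊆ T × Unique (map (colourOf N) E))

  labelled-colours : ∀ b vs → All (λ v → m v ≡ b) vs → All (_∉ D) vs → length vs ≤ δ →
    map (colourOf N) (pendantEdges 0 vs) ≡ map (colour b) (range 0 (length vs))
  labelled-colours b vs labels vs∉D ∣vs∣≤δ =
    pendantEdges-colours (labelColour b) 0 vs (All.map (λ mv≡b i → cong (λ c → labelColour c i) mv≡b) labels) vs∉D ∣vs∣≤δ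

  -- The vertices of F
  -- use the colours 0, 1, … upwards, those of Tr the colours k-1, k-2, … downwards; since
  -- |F| + |Tr| ≤ k these are all distinct.
  both-classes-small : ∀ S (SD F Tr : List (Fin n)) → All (λ v → m v ≡ false) F → All (λ v → m v ≡ true) Tr →
    All (_∉ D) F → All (_∉ D) Tr → Unique (F ++ Tr) → length F ≤ δ → length Tr ≤ δ →
    length SD + (length F + length Tr) ≡ k → All (_∈ D) SD →
    (∀ {x} → x ∈ S → x ∈ D → x ∈ˡ SD) → (∀ {x} → x ∈ S → x ∉ D → x ∈ˡ (F ++ Tr)) → RainbowTreeThrough S
  both-classes-small S SD F Tr labels-F labels-T F∉D T∉D unique-FT ∣F∣≤δ ∣T∣≤δ sizes SD⊆D S∩D⊆SD S∖D⊆FT =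
    rainbow-tree-from-leaves G k (suc k) D N (high-cover cover) S A L A⊆D ∣A∣≤k S∩D⊆A S∖D⊆L L∉D
      (subst Unique (≡-sym leaves) unique-FT) (parentsIn-start A L (All.tabulate (λ h → ∈-++⁺ʳ SD (∈-map⁺ proj₂ h))))
      (AllP.++⁺ (All.map proj₁ valid-F) (All.map proj₁ valid-T)) distinct lowL
    where
    L-F L-T L : List (Edge n)
    L-F = pendantEdges 0 F
    L-T = pendantEdges 0 Tr
    L = L-F ++ L-T
    A : List (Fin n)
    A = SD ++ map proj₂ L
    valid-F : All (PendantIn G D) L-F
    valid-F = pendantEdges-valid 0 F F∉D ∣F∣≤δ
    valid-T : All (PendantIn G D) L-T
    valid-T = pendantEdges-valid 0 Tr T∉D ∣T∣≤δ
    leaves : map proj₁ L ≡ F ++ Tr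
    leaves = trans (map-++ proj₁ L-F L-T) (cong₂ _++_ (pendantEdges-leaves 0 F) (pendantEdges-leaves 0 Tr))
    colours : map (colourOf N) L ≡ map (colour false) (range 0 (length F)) ++ map (colour true) (range 0 (length Tr))
    colours = trans (map-++ (colourOf N) L-F L-T)
                    (cong₂ _++_ (labelled-colours false F labels-F F∉D ∣F∣≤δ) (labelled-colours true Tr labels-T T∉D ∣T∣≤δ))
    A⊆D : All (_∈ D) A
    A⊆D = AllP.++⁺ SD⊆D (AllP.map⁺ (AllP.++⁺ (All.map proj₂ valid-F) (All.map proj₂ valid-T)))
    ∣A∣≤k : length A ≤ k
    ∣A∣≤k = ≤-reflexive (trans (length-++ SD) (trans (cong (length SD +_) (trans (length-map proj₂ L)
              (trans (length-++ L-F) (cong₂ _+_ (length-pendantEdges 0 F) (length-pendantEdges 0 Tr))))) sizes))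
    S∩D⊆A : ∀ {x} → x ∈ S → x ∈ D → x ∈ˡ A
    S∩D⊆A x∈S x∈D = ∈-++⁺ˡ (S∩D⊆SD x∈S x∈D)
    S∖D⊆L : ∀ {x} → x ∈ S → x ∉ D → x ∈ˡ map proj₁ L
    S∖D⊆L x∈S x∉D = subst (_ ∈ˡ_) (≡-sym leaves) (S∖D⊆FT x∈S x∉D)
    L∉D : All (λ e → proj₁ e ∉ D) L
    L∉D = AllP.++⁺ (pendantEdges-outside 0 F F∉D) (pendantEdges-outside 0 Tr T∉D)
    F+T≤k : length F + length Tr ≤ k
    F+T≤k = subst (length F + length Tr ≤_) sizes (m≤n+m _ (length SD))
    apart : ∀ {c} → ¬ (c ∈ˡ map (colour false) (range 0 (length F)) × c ∈ˡ map (colour true) (range 0 (length Tr)))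
    apart (h₁ , h₂) with ∈-map⁻ (colour false) h₁ | ∈-map⁻ (colour true) h₂
    ... | i , i∈ , refl | j , j∈ , e = up≢down F+T≤k (proj₂ (range-bounds 0 _ i∈)) (proj₂ (range-bounds 0 _ j∈)) e
    distinct : Unique (map (colourOf N) L)
    distinct = subst Unique (≡-sym colours) (UniqueP.++⁺ up down apart)
      where
      up : Unique (map (colour false) (range 0 (length F)))
      up = range-map-unique (colour false) k (length F) (≤-trans ∣F∣≤δ (n≤1+n δ)) (colour-injective false)
      down : Unique (map (colour true) (range 0 (length Tr)))
      down = range-map-unique (colour true) k (length Tr) (≤-trans ∣T∣≤δ (n≤1+n δ)) (colour-injective true)
    lowL : All (Low (suc k)) (map (colourOf N) L)
    lowL = subst (All (Low (suc k))) (≡-sym colours)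
      (AllP.++⁺ (AllP.map⁺ (All.universal (low-colour false) (range 0 (length F))))
                (AllP.map⁺ (All.universal (low-colour true) (range 0 (length Tr)))))

  -- Read in the other orientation, the last colour number δ is number 0.
  top-reversed : toℕ (opposite (clamp δ δ)) ≡ 0
  top-reversed = trans (FP.opposite-prop (clamp δ δ)) (trans (cong (λ z → k ∸ suc z) (toℕ-clamp δ δ ≤-refl)) (n∸n≡0 δ))

  other-orientation : ∀ c b → c ≢ b → toℕ (orient c (orient b (clamp δ δ))) ≡ 0
  other-orientation false false c≢b = ⊥-elim (c≢b refl)
  other-orientation true  true  c≢b = ⊥-elim (c≢b refl)
  other-orientation false true  _   = top-reversed
  other-orientation true  false _   = top-reversed

  -- The vertices of rest use the colours 0, …, δ-1 of label b; u is joined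
  --   • if u is full, to its (δ+1)-st neighbour in D, with the last colour of label b;
  --   • otherwise (u is good) via a neighbour w ∉ D by a star edge: if w ∈ rest nothing more is
  --     needed; otherwise w (full, or labelled ≠ b) is joined to one of its D-neighbours by the
  --     last colour of label b.
  module OneClass (S : Subset n) (b : Bool) (u : Fin n) (rest : List (Fin n))
    (u-label : m u ≡ b) (rest-labels : All (λ v → m v ≡ b) rest)
    (u∉D : u ∉ D) (rest∉D : All (_∉ D) rest) (u∉rest : ¬ (u ∈ˡ rest)) (rest-unique : Unique rest)
    (∣rest∣ : length rest ≡ δ)
    (S∖D⊆ : ∀ {x} → x ∈ S → x ∉ D → x ∈ˡ (u ∷ rest)) (S∉D : ∀ {x} → x ∈ S → x ∉ D) where

    L₁ : List (Edge n)
    L₁ = pendantEdges 0 rest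
    A₁ : List (Fin n)
    A₁ = map proj₂ L₁
    valid₁ : All (PendantIn G D) L₁
    valid₁ = pendantEdges-valid 0 rest rest∉D (≤-reflexive ∣rest∣)

    colours₁ : map (colourOf N) L₁ ≡ map (colour b) (range 0 δ)
    colours₁ = trans (labelled-colours b rest rest-labels rest∉D (≤-reflexive ∣rest∣))
                     (cong (λ l → map (colour b) (range 0 l)) ∣rest∣)

    leaves₁ : map proj₁ L₁ ≡ rest
    leaves₁ = pendantEdges-leaves 0 rest

    complete : (ex : List (Edge n)) (Ax : List (Fin n)) → All (_∈ D) Ax → length Ax ≤ 1 →
      u ∈ˡ map proj₁ ex → All (λ e → proj₁ e ∉ D) ex → Unique (rest ++ map proj₁ ex) →
      ParentsIn (map proj₁ L₁ ++ (A₁ ++ Ax)) ex → All (λ e → Adj G (proj₁ e) (proj₂ e)) ex →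
      Unique (map (colour b) (range 0 δ) ++ map (colourOf N) ex) → All (Low (suc k)) (map (colourOf N) ex) →
      RainbowTreeThrough S
    complete ex Ax Ax⊆D ∣Ax∣≤1 u∈ex ex∉D unique-leaves parents adj-ex unique-colours low-ex =
      rainbow-tree-from-leaves G k (suc k) D N (high-cover cover) S (A₁ ++ Ax) (L₁ ++ ex)
        (AllP.++⁺ (AllP.map⁺ (All.map proj₂ valid₁)) Ax⊆D) ∣A∣≤k (λ x∈S x∈D → ⊥-elim (S∉D x∈S x∈D)) S∖D⊆L
        (AllP.++⁺ (pendantEdges-outside 0 rest rest∉D) ex∉D) (subst Unique (≡-sym leaves) unique-leaves)
        (parentsIn-++ (A₁ ++ Ax) L₁ ex (parentsIn-start (A₁ ++ Ax) L₁ (All.tabulate (λ h → ∈-++⁺ˡ (∈-map⁺ proj₂ h)))) parents)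
        (AllP.++⁺ (All.map proj₁ valid₁) adj-ex)
        (subst Unique (≡-sym colours) unique-colours)
        (subst (All (Low (suc k))) (≡-sym colours) (AllP.++⁺ (AllP.map⁺ (All.universal (low-colour b) (range 0 δ))) low-ex))
      where
      leaves : map proj₁ (L₁ ++ ex) ≡ rest ++ map proj₁ ex
      leaves = trans (map-++ proj₁ L₁ ex) (cong (_++ map proj₁ ex) leaves₁)
      colours : map (colourOf N) (L₁ ++ ex) ≡ map (colour b) (range 0 δ) ++ map (colourOf N) ex
      colours = trans (map-++ (colourOf N) L₁ ex) (cong (_++ map (colourOf N) ex) colours₁)
      ∣A∣≤k : length (A₁ ++ Ax) ≤ k
      ∣A∣≤k = subst (_≤ k) (≡-sym (trans (length-++ A₁) (cong (_+ length Ax)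
                (trans (length-map proj₂ L₁) (trans (length-pendantEdges 0 rest) ∣rest∣)))))
                (≤-trans (+-monoʳ-≤ δ ∣Ax∣≤1) (≤-reflexive (+-comm δ 1)))
      S∖D⊆L : ∀ {x} → x ∈ S → x ∉ D → x ∈ˡ map proj₁ (L₁ ++ ex)
      S∖D⊆L x∈S x∉D with S∖D⊆ x∈S x∉D
      ... | here refl = subst (_ ∈ˡ_) (≡-sym leaves) (∈-++⁺ʳ rest u∈ex)
      ... | there h   = subst (_ ∈ˡ_) (≡-sym leaves) (∈-++⁺ˡ h)

    rest-then-u : Unique (rest ++ u ∷ [])
    rest-then-u = UniqueP.++⁺ rest-unique ([] ∷ []) (λ { (h , here refl) → u∉rest h })

    -- u is full: its neighbour number δ in D gives the last colour.
    via-full : Full u → RainbowTreeThrough S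
    via-full full = complete ((u , t) ∷ []) (t ∷ []) (proj₂ (neighboursIn-adj G D t∈) ∷ []) ≤-refl (here refl) (u∉D ∷ [])
      rest-then-u (∈-++⁺ʳ (map proj₁ L₁) (∈-++⁺ʳ A₁ (here refl)) , tt) (proj₁ (neighboursIn-adj G D t∈) ∷ [])
      (subst (λ c → Unique (map (colour b) (range 0 δ) ++ c ∷ [])) (≡-sym is-last)
             (first-colours-then b (last b ∷ []) ([] ∷ []) ((λ i i<δ → colour≢last b i i<δ) ∷ [])))
      (subst (Low (suc k)) (≡-sym is-last) (low-colour b δ) ∷ [])
      where
      δ< : δ < length (neighboursIn G D u)
      δ< = subst (k ≤_) (≡-sym (length-toList (nbrs G u ∩ D))) full
      t : Fin n
      t = nth (neighboursIn G D u) δ u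
      t∈ : t ∈ˡ neighboursIn G D u
      t∈ = nth-∈ (neighboursIn G D u) δ u δ<
      is-last : N u t ≡ last b
      is-last = trans (pendant-colour δ u∉D δ<) (cong (λ c → colour c δ) u-label)

    -- u has a neighbour w ∈ rest outside D: the star edge u w joins u.
    via-rest : ∀ {w} → Adj G u w → w ∉ D → w ∈ˡ rest → RainbowTreeThrough S
    via-rest {w} u~w w∉D w∈rest = complete ((u , w) ∷ []) [] [] z≤n (here refl) (u∉D ∷ []) rest-then-u
      (∈-++⁺ˡ (subst (w ∈ˡ_) (≡-sym leaves₁) w∈rest) , tt) (u~w ∷ [])
      (subst (λ c → Unique (map (colour b) (range 0 δ) ++ c ∷ [])) (≡-sym (N-outside u∉D w∉D))
             (first-colours-then b (star ∷ []) ([] ∷ []) ((λ i _ → colour≢star b i) ∷ [])))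
      (subst (Low (suc k)) (≡-sym (N-outside u∉D w∉D)) low-star ∷ [])

    -- u has a neighbour w ∉ rest outside D that is full or labelled ≠ b: w is joined to the
    -- D-neighbour whose colour (in w's orientation) is the last colour of label b.
    via-neighbour : ∀ {w} → Adj G u w → w ∉ D → ¬ (w ∈ˡ rest) → Full w ⊎ m w ≢ b → RainbowTreeThrough S
    via-neighbour {w} u~w w∉D w∉rest full-or-other =
      complete ((w , d) ∷ (u , w) ∷ []) (d ∷ []) (proj₂ (neighboursIn-adj G D d∈) ∷ []) ≤-refl (there (here refl))
        (w∉D ∷ u∉D ∷ []) leaves-unique
        (∈-++⁺ʳ (map proj₁ L₁) (∈-++⁺ʳ A₁ (here refl)) , here refl , tt) (proj₁ (neighboursIn-adj G D d∈) ∷ u~w ∷ [])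
        (subst₂ (λ c c' → Unique (map (colour b) (range 0 δ) ++ c ∷ c' ∷ [])) (≡-sym is-last) (≡-sym (N-outside u∉D w∉D))
                (first-colours-then b (last b ∷ star ∷ []) ((colour≢star b δ ∷ []) ∷ [] ∷ [])
                   ((λ i i<δ → colour≢last b i i<δ) ∷ (λ i _ → colour≢star b i) ∷ [])))
        (subst (Low (suc k)) (≡-sym is-last) (low-colour b δ) ∷ subst (Low (suc k)) (≡-sym (N-outside u∉D w∉D)) low-star ∷ [])
      where
      target : Fin k
      target = orient (m w) (orient b (clamp δ δ))
      j : ℕ
      j = toℕ target
      index-ok : Full w ⊎ m w ≢ b → j < length (neighboursIn G D w)
      index-ok (inj₁ full)  = ≤-trans (FP.toℕ<n target) (subst (k ≤_) (≡-sym (length-toList (nbrs G w ∩ D))) full)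
      index-ok (inj₂ other) = subst (_< length (neighboursIn G D w)) (≡-sym (other-orientation (m w) b other))
                           (≤-trans (s≤s z≤n) (subst (δ ≤_) (≡-sym (length-toList (nbrs G w ∩ D))) (dom w w∉D)))
      j< : j < length (neighboursIn G D w)
      j< = index-ok full-or-other
      d : Fin n
      d = nth (neighboursIn G D w) j w
      d∈ : d ∈ˡ neighboursIn G D w
      d∈ = nth-∈ (neighboursIn G D w) j w j<
      is-last : N w d ≡ last b
      is-last = trans (pendant-colour j w∉D j<)
        (cong (λ z → inject₁ z ↑ˡ q) (trans (cong (orient (m w)) (clamp-toℕ δ target)) (orient-involutive (m w) _)))
      leaves-unique : Unique (rest ++ w ∷ u ∷ [])
      leaves-unique = UniqueP.++⁺ rest-unique (((λ w≡u → adj-≢ G u~w (≡-sym w≡u)) ∷ []) ∷ [] ∷ []) apart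
        where
        apart : ∀ {c} → ¬ (c ∈ˡ rest × c ∈ˡ (w ∷ u ∷ []))
        apart (h , here refl)         = w∉rest h
        apart (h , there (here refl)) = u∉rest h

    tree : RainbowTreeThrough S
    tree with Full? u
    ... | yes full = via-full full
    ... | no not-full with good u u∉D not-full
    ...   | w , u~w , w∉D , full-or-other with Any.any? (w FP.≟_) rest
    ...     | yes w∈rest = via-rest u~w w∉D w∈rest
    ...     | no  w∉rest = via-neighbour u~w w∉D w∉rest
                             (map₂ (λ other e → other (trans e (≡-sym u-label))) full-or-other)

  private
    empty-by-size : ∀ {A : Set} {x : A} {xs a b} → b ≤ a → a + length xs ≤ b → ¬ (x ∈ˡ xs)
    empty-by-size {xs = _ ∷ xs} {a} b≤a le _ = <-irrefl refl (≤-trans (m<m+n a (s≤s z≤n)) (≤-trans le b≤a))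

    not-false : ∀ {c : Bool} → ¬ (c ≡ false) → c ≡ true
    not-false {true}  _  = refl
    not-false {false} ne = ⊥-elim (ne refl)

  one-class : ∀ S b (cls : List (Fin n)) → All (λ v → m v ≡ b) cls → All (_∉ D) cls → Unique cls →
    δ < length cls → length cls ≤ k → (∀ {x} → x ∈ S → x ∉ D → x ∈ˡ cls) → (∀ {x} → x ∈ S → x ∉ D) →
    RainbowTreeThrough S
  one-class S b (u ∷ rest) (u-label ∷ labels) (u∉D ∷ rest∉D) (u∉rest ∷ rest-unique) more at-most covers S∉D =
    OneClass.tree S b u rest u-label labels u∉D rest∉D (AllP.All¬⇒¬Any u∉rest) rest-unique
      (≤-antisym (≤-pred at-most) (≤-pred more)) covers S∉D

  rainbow : IsKRainbowOn G ⊤ k colouring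
  rainbow S _ ∣S∣≡k = by-class-sizes (length F ≤? δ) (length Tr ≤? δ)
    where
    module ByD = Partition (partition (_∈? D) (toList S) (toList-unique S))
    vs : List (Fin n)
    vs = ByD.no-part
    module ByLabel = Partition (partition (λ v → m v Bool.≟ false) vs ByD.no-unique)
    F Tr : List (Fin n)
    F = ByLabel.yes-part
    Tr = ByLabel.no-part
    sizes-D : length ByD.yes-part + length vs ≡ k
    sizes-D = trans ByD.sizes (trans (length-toList S) ∣S∣≡k)
    vs≤k : length vs ≤ k
    vs≤k = subst (length vs ≤_) sizes-D (m≤n+m _ _)
    F≤vs : length F ≤ length vs
    F≤vs = subst (length F ≤_) ByLabel.sizes (m≤m+n _ _)
    T≤vs : length Tr ≤ length vs
    T≤vs = subst (length Tr ≤_) ByLabel.sizes (m≤n+m _ _)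
    F∉D : All (_∉ D) F
    F∉D = All.tabulate (λ h → All.lookup ByD.no-all (ByLabel.yes-⊆ h))
    T∉D : All (_∉ D) Tr
    T∉D = All.tabulate (λ h → All.lookup ByD.no-all (ByLabel.no-⊆ h))
    labels-T : All (λ v → m v ≡ true) Tr
    labels-T = All.map not-false ByLabel.no-all
    S∩D⊆SD : ∀ {x} → x ∈ S → x ∈ D → x ∈ˡ ByD.yes-part
    S∩D⊆SD x∈S x∈D = ByD.yes-cover (toList⁺ x∈S) x∈D
    S∖D⊆FT : ∀ {x} → x ∈ S → x ∉ D → x ∈ˡ (F ++ Tr)
    S∖D⊆FT {x} x∈S x∉D with m x Bool.≟ false
    ... | yes e  = ∈-++⁺ˡ (ByLabel.yes-cover x∈vs e)
      where x∈vs = ByD.no-cover (toList⁺ x∈S) x∉D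
    ... | no  ne = ∈-++⁺ʳ F (ByLabel.no-cover (ByD.no-cover (toList⁺ x∈S) x∉D) ne)
    S∉D : k ≤ length vs → ∀ {x} → x ∈ S → x ∉ D
    S∉D k≤vs x∈S x∈D = empty-by-size k≤vs (≤-reflexive (trans (+-comm (length vs) _) sizes-D)) (S∩D⊆SD x∈S x∈D)
    by-class-sizes : Dec (length F ≤ δ) → Dec (length Tr ≤ δ) → RainbowTreeThrough S
    by-class-sizes (yes F≤δ) (yes T≤δ) =
      both-classes-small S ByD.yes-part F Tr ByLabel.yes-all labels-T F∉D T∉D
        (UniqueP.++⁺ ByLabel.yes-unique ByLabel.no-unique (λ (h₁ , h₂) → All.lookup ByLabel.no-all h₂ (All.lookup ByLabel.yes-all h₁)))
        F≤δ T≤δ (trans (cong (length ByD.yes-part +_) ByLabel.sizes) sizes-D) ByD.yes-all S∩D⊆SD S∖D⊆FT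
    by-class-sizes (no F>δ) _ =
      one-class S false F ByLabel.yes-all F∉D ByLabel.yes-unique (≰⇒> F>δ) (≤-trans F≤vs vs≤k) covers
        (S∉D (≤-trans (≰⇒> F>δ) F≤vs))
      where
      covers : ∀ {x} → x ∈ S → x ∉ D → x ∈ˡ F
      covers x∈S x∉D with ∈-++⁻ F (S∖D⊆FT x∈S x∉D)
      ... | inj₁ h = h
      ... | inj₂ h = ⊥-elim (empty-by-size (≰⇒> F>δ) (subst (_≤ k) (≡-sym ByLabel.sizes) vs≤k) h)
    by-class-sizes (yes _) (no T>δ) =
      one-class S true Tr labels-T T∉D ByLabel.no-unique (≰⇒> T>δ) (≤-trans T≤vs vs≤k) covers
        (S∉D (≤-trans (≰⇒> T>δ) T≤vs))
      where
      covers : ∀ {x} → x ∈ S → x ∉ D → x ∈ˡ Tr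
      covers x∈S x∉D with ∈-++⁻ F (S∖D⊆FT x∈S x∉D)
      ... | inj₂ h = h
      ... | inj₁ h = ⊥-elim (empty-by-size (≰⇒> T>δ)
                       (subst (_≤ k) (≡-sym (trans (+-comm (length Tr) (length F)) ByLabel.sizes)) vs≤k) h)

  rainbow-colouring : Σ (Colouring G (suc k + q)) (IsKRainbowOn G ⊤ k)
  rainbow-colouring = colouring , rainbow

part-two-colouring : ∀ (G : Graph n) k₁ (D : Subset n) → IsDominating G (suc k₁) D → MinDegree≥ G (suc (suc k₁)) →
  Construction G D (suc (suc k₁)) (suc (suc (suc k₁)))
part-two-colouring G k₁ D dom mindeg C C-sym cover = PartTwo.rainbow-colouring G k₁ D dom mindeg C C-sym cover

rainbow-index-≤ : ∀ {G : Graph n} {k r m} → IsRainbowIndex G k r → Σ (Colouring G m) (IsKRainbowOn G ⊤ k) → r ≤ m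
rainbow-index-≤ {m = m} (_ , _ , _ , _ , minimal) (c , rainbow) = minimal m c rainbow

-- Feeding a construction with the cover obtained from an optimal k-rainbow colouring of
-- G[D] gives rx_k(G) ≤ p + rx_k(G[D]); with the cover obtained from a spanning tree of G[D]
-- (|D| - 1 colours), rx_k(G) ≤ (p - 1) + |D|.
bound-by-rainbow-index : ∀ {G : Graph n} {D k p r rD} → Construction G D k p →
  IsRainbowIndex G k r → IsRainbowIndexOn G D k rD → r ≤ p + rD
bound-by-rainbow-index {G = G} {D} {k} {p} construct rx (_ , _ , k≤∣D∣ , (c , rainbow) , _) =
  rainbow-index-≤ rx (construct (λ u w → p ↑ʳ col c u w) (λ u w → cong (p ↑ʳ_) (colSym c u w))
                                  (shifted-rainbow-cover G D k p c rainbow k≤∣D∣))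

bound-by-spanning-tree : ∀ {G : Graph n} {D k p r} → Construction G D k (suc p) → ConnectedOn G D →
  IsRainbowIndex G k r → r ≤ p + ∣ D ∣
bound-by-spanning-tree {n} {G = G} {D} {k} {p} {r} construct connected rx with spanning-tree G D connected
... | T , E , tree , D⊆T , norep = subst (r ≤_) colours (rainbow-index-≤ rx (construct C (treeColouring-sym (suc p) E d) cover))
  where
  d : Fin (suc p + length E)
  d = zero ↑ˡ length E
  C : Fin n → Fin n → Fin (suc p + length E)
  C = treeColouring (suc p) E d
  cover : HighRainbowCover G D k (suc p) C
  cover = spanning-tree-cover G D T E (suc p) k d tree D⊆T norep
  colours : suc p + length E ≡ p + ∣ D ∣
  colours = trans (≡-sym (+-suc p (length E))) (cong (p +_) (spanning-tree-size {G = G} tree D⊆T))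

theorem3p12 : (k n : ℕ) → 2 ≤ k → (G : Graph n) → Connected G → k ≤ n →
    ((D : Subset n) → IsConnDominating G k D →
    (r rD : ℕ) → IsRainbowIndex G k r → IsRainbowIndexOn G D k rD →
    r ≤ rD + k)
    × ((g r : ℕ) → IsConnDomNumber G k g → IsRainbowIndex G k r →
    r ≤ g + k ∸ 1)
    × (MinDegree≥ G k →
    ((D : Subset n) → IsConnDominating G (k ∸ 1) D →
    (r rD : ℕ) → IsRainbowIndex G k r → IsRainbowIndexOn G D k rD →
    r ≤ rD + k + 1)
    × ((g r : ℕ) → IsConnDomNumber G (k ∸ 1) g → IsRainbowIndex G k r →
    r ≤ g + k))
theorem3p12 (suc (suc k₁)) n (s≤s (s≤s z≤n)) G _ _ =
  (λ D (dom , _) r rD rx rxD →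
     subst (r ≤_) (+-comm k rD) (bound-by-rainbow-index (part-one-colouring G δ D dom) rx rxD)) ,
  (λ g r ((D , (dom , connected) , ∣D∣≡g) , _) rx →
     subst (r ≤_) (trans (+-comm δ ∣ D ∣) (trans (cong (_+ δ) ∣D∣≡g) (cong (_∸ 1) (≡-sym (+-suc g δ)))))
           (bound-by-spanning-tree (part-one-colouring G δ D dom) connected rx)) ,
  (λ mindeg →
     (λ D (dom , _) r rD rx rxD →
        subst (r ≤_) (trans (+-comm (suc k) rD) (trans (+-suc rD k) (+-comm 1 (rD + k))))
              (bound-by-rainbow-index (part-two-colouring G k₁ D dom mindeg) rx rxD)) ,
     (λ g r ((D , (dom , connected) , ∣D∣≡g) , _) rx →
        subst (r ≤_) (trans (+-comm k ∣ D ∣) (cong (_+ k) ∣D∣≡g))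
              (bound-by-spanning-tree (part-two-colouring G k₁ D dom mindeg) connected rx)))
  where
  δ k : ℕ
  δ = suc k₁
  k = suc δ
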